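{- Let $q>2$ be even and let $\mathcal{E}$ be a set of solids of $\mathrm{PG}(4,q)$ such that every point of $\mathrm{PG}(4,q)$ lies in either $0$, $\frac12q^3$ or $\frac12(q^3-q^2)$ solids of $\mathcal{E}$, and every plane lies in either $0$, $\frac12q$ or $q$ solids of $\mathcal{E}$. If $|\mathcal{E}|=\frac12q^3(q-1)$, then $\mathrm{PG}(4,q)$ contains exactly $q+2$ red points, $q^2-1$ white points and $q^4+q^3$ black points.
   Context: A solid of $\mathrm{PG}(4,q)$ is a hyperplane. A point is called red if it lies in $0$ solids of $\mathcal{E}$, white if it lies in $\frac12q^3$ solids of $\mathcal{E}$, and black if it lies in $\frac12(q^3-q^2)$ solids of $\mathcal{E}$. -}

module Defs where

open import Level using (0ℓ)
open import Algebra.Bundles using (CommutativeRing)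
open import Data.Nat using (ℕ; zero; suc; _∸_; _^_; _/_; _≟_)
open import Data.Vec using (Vec; []; _∷_; zipWith)
open import Data.Vec.Relation.Unary.All using (All)
open import Data.List using (List; []; _∷_; length; filter; concatMap; map)
open import Data.List.Relation.Unary.Any using (Any)
open import Data.List.Relation.Unary.AllPairs using (AllPairs)
open import Data.Product using (_×_; _,_; ∃)
open import Data.Empty using (⊥)
open import Data.Sum using (_⊎_; inj₁; inj₂)
open import Relation.Nullary using (¬_; Dec; yes; no)
open import Relation.Nullary.Decidable using (_×-dec_; _⊎-dec_)
open import Relation.Unary using (Pred; Decidable)
open import Relation.Binary.PropositionalEquality using (_≡_)
import Relation.Binary as B

record FiniteField : Set₁ where
  field
    commRing : CommutativeRing 0ℓ 0ℓ
  open CommutativeRing commRing public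
  field
    _≈?_         : B.Decidable _≈_
    1≉0          : ¬ (1# ≈ 0#)
    inverse      : ∀ x → ¬ (x ≈ 0#) → ∃ λ y → x * y ≈ 1#
    order        : ℕ
    elems        : List Carrier
    complete     : ∀ x → Any (x ≈_) elems
    distinct     : AllPairs (λ x y → ¬ (x ≈ y)) elems
    length-elems : length elems ≡ order

V5 : FiniteField → Set
V5 F = Vec (FiniteField.Carrier F) 5

module PG (F : FiniteField) where
  open FiniteField F

  -- All vectors of F^n (one representative per ≈-class of coordinates).
  allVecs : (n : ℕ) → List (Vec Carrier n)
  allVecs zero    = [] ∷ []
  allVecs (suc n) = concatMap (λ x → map (x ∷_) (allVecs n)) elems

  -- Normalised vectors: the first nonzero coordinate equals 1.
  -- These are exactly one representative of each 1-dim subspace.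
  Normalised : ∀ {n} → Vec Carrier n → Set
  Normalised []       = ⊥
  Normalised (x ∷ xs) = (x ≈ 1#) ⊎ ((x ≈ 0#) × Normalised xs)

  normalised? : ∀ {n} → Decidable (Normalised {n})
  normalised? []       = no (λ ())
  normalised? (x ∷ xs) = (x ≈? 1#) ⊎-dec ((x ≈? 0#) ×-dec normalised? xs)

  -- Points of PG(4,q): normalised nonzero vectors of F^5.
  -- Solids (hyperplanes) of PG(4,q): by duality also normalised nonzero
  -- vectors u of F^5 (the solid being { x | u · x = 0 }).
  points : List (Vec Carrier 5)
  points = filter normalised? (allVecs 5)

  solids : List (Vec Carrier 5)
  solids = points

  dot : ∀ {n} → Vec Carrier n → Vec Carrier n → Carrier
  dot []       []       = 0#
  dot (a ∷ as) (b ∷ bs) = a * b + dot as bs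

  _⊇pt_ : Vec Carrier 5 → Vec Carrier 5 → Set
  u ⊇pt x = dot u x ≈ 0#

  _⊇pt?_ : ∀ u x → Dec (u ⊇pt x)
  u ⊇pt? x = dot u x ≈? 0#

  comb : Carrier → Carrier → Carrier → Vec Carrier 5 → Vec Carrier 5 → Vec Carrier 5 → Vec Carrier 5
  comb a b c x y z =
    zipWith _+_ (zipWith _+_ (Data.Vec.map (a *_) x) (Data.Vec.map (b *_) y)) (Data.Vec.map (c *_) z)

  -- x, y, z linearly independent in F^5; their span is a plane of PG(4,q),
  -- and every plane arises this way.
  LinIndep3 : Vec Carrier 5 → Vec Carrier 5 → Vec Carrier 5 → Set
  LinIndep3 x y z = ∀ a b c → All (_≈ 0#) (comb a b c x y z) → (a ≈ 0#) × (b ≈ 0#) × (c ≈ 0#)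

  -- A set 𝓔 of solids is given by a decidable predicate on solid coordinates
  -- (only the entries of `solids` are relevant).
  module _ (𝓔 : Pred (Vec Carrier 5) 0ℓ) (𝓔? : Decidable 𝓔) where

    size : ℕ
    size = length (filter 𝓔? solids)

    solidsThroughPoint : Vec Carrier 5 → ℕ
    solidsThroughPoint x = length (filter (λ u → 𝓔? u ×-dec (u ⊇pt? x)) solids)

    solidsThroughPlane : Vec Carrier 5 → Vec Carrier 5 → Vec Carrier 5 → ℕ
    solidsThroughPlane x y z =
      length (filter (λ u → 𝓔? u ×-dec ((u ⊇pt? x) ×-dec ((u ⊇pt? y) ×-dec (u ⊇pt? z)))) solids)

    pointsWith : ℕ → ℕ
    pointsWith k = length (filter (λ x → solidsThroughPoint x ≟ k) points)

    q : ℕ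
    q = order

    redCount whiteCount blackCount : ℕ
    redCount   = pointsWith 0
    whiteCount = pointsWith ((q ^ 3) / 2)
    blackCount = pointsWith ((q ^ 3 ∸ q ^ 2) / 2)

module Submission where

-- Proof by double counting.  Let s(x) be the number of solids of 𝓔 through
-- the point x and r, w, b the numbers of red, white and black points.  A solid
-- has θ(4) points and two distinct solids meet in a plane of θ(3) points,
-- where θ(n) = 1 + q + ⋯ + qⁿ⁻¹ is the number of points of PG(n − 1, q).
-- Counting points, incident pairs (x, S) and incident triples (x, S, S′) gives
--     r + w + b     = θ(5),
--     w·A + b·B     = |𝓔|·θ(4),
--     w·A² + b·B²   = |𝓔|·θ(4) + |𝓔|(|𝓔| − 1)·θ(3),
-- with A = q³/2 and B = (q³ − q²)/2.  As A > B > 0 the last two equations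
-- determine w and b, and then the first determines r; the claimed numbers
-- are a solution.

open import Defs
open import Data.Nat using (ℕ; zero; suc)
open import Data.Product using (_×_)
open import Data.Sum using (_⊎_)
open import Relation.Nullary using (¬_)
open import Relation.Binary.PropositionalEquality using (_≡_)

module FiniteSums where

  open import Data.Nat using (_+_; _*_)
  open import Data.Nat.Properties
    using (+-identityʳ; +-assoc; *-zeroʳ; *-distribˡ-+; *-comm)
  open import Data.Nat.Solver using (module +-*-Solver)
  open +-*-Solver using (solve; _:+_; _:=_)
  open import Data.List using (List; []; _∷_; length; filter; concatMap; map; _++_)
  open import Data.List.Relation.Unary.All using (All; []; _∷_)
  open import Data.Empty using (⊥-elim)
  open import Relation.Nullary using (Dec; yes; no)
  open import Relation.Nullary.Decidable using (_×-dec_; _⊎-dec_)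
  open import Relation.Unary using (Decidable)
  open import Relation.Binary.PropositionalEquality using (refl; cong; cong₂; sym; trans)

  sumOver : {A : Set} → List A → (A → ℕ) → ℕ
  sumOver []      f = 0
  sumOver (x ∷ l) f = f x + sumOver l f

  infix 6.5 sumOver
  syntax sumOver l (λ x → e) = ∑[ x ∈ l ] e

  𝟙 : {P : Set} → Dec P → ℕ
  𝟙 (yes _) = 1
  𝟙 (no _)  = 0

  module _ {A : Set} where

    length-filter : {P : A → Set} (P? : Decidable P) (l : List A) →
      length (filter P? l) ≡ ∑[ x ∈ l ] 𝟙 (P? x)
    length-filter P? [] = refl
    length-filter P? (x ∷ l) with P? x
    ... | yes _ = cong suc (length-filter P? l)
    ... | no _  = length-filter P? l

    sum-filter : {P : A → Set} (P? : Decidable P) (l : List A) (f : A → ℕ) →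
      ∑[ x ∈ filter P? l ] f x ≡ ∑[ x ∈ l ] 𝟙 (P? x) * f x
    sum-filter P? [] f = refl
    sum-filter P? (x ∷ l) f with P? x
    ... | yes _ = cong₂ _+_ (sym (+-identityʳ (f x))) (sum-filter P? l f)
    ... | no _  = sum-filter P? l f

    sum-cong : (l : List A) {f g : A → ℕ} → (∀ x → f x ≡ g x) → sumOver l f ≡ sumOver l g
    sum-cong []      e = refl
    sum-cong (x ∷ l) e = cong₂ _+_ (e x) (sum-cong l e)

    sum-congAll : {l : List A} {f g : A → ℕ} → All (λ x → f x ≡ g x) l → sumOver l f ≡ sumOver l g
    sum-congAll []       = refl
    sum-congAll (e ∷ es) = cong₂ _+_ e (sum-congAll es)

    sum-++ : (l m : List A) (f : A → ℕ) → sumOver (l ++ m) f ≡ sumOver l f + sumOver m f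
    sum-++ []      m f = refl
    sum-++ (x ∷ l) m f = trans (cong (f x +_) (sum-++ l m f)) (sym (+-assoc (f x) _ _))

    sum-+ : (l : List A) (f g : A → ℕ) → ∑[ x ∈ l ] (f x + g x) ≡ sumOver l f + sumOver l g
    sum-+ []      f g = refl
    sum-+ (x ∷ l) f g = trans (cong (f x + g x +_) (sum-+ l f g))
      (solve 4 (λ a b c d → (a :+ b) :+ (c :+ d) := (a :+ c) :+ (b :+ d)) refl
        (f x) (g x) (sumOver l f) (sumOver l g))

    sum-*ˡ : (l : List A) (c : ℕ) (f : A → ℕ) → ∑[ x ∈ l ] c * f x ≡ c * sumOver l f
    sum-*ˡ []      c f = sym (*-zeroʳ c)
    sum-*ˡ (x ∷ l) c f = trans (cong (c * f x +_) (sum-*ˡ l c f)) (sym (*-distribˡ-+ c (f x) _))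

    sum-*ʳ : (l : List A) (c : ℕ) (f : A → ℕ) → ∑[ x ∈ l ] f x * c ≡ sumOver l f * c
    sum-*ʳ l c f = trans (sum-cong l (λ x → *-comm (f x) c)) (trans (sum-*ˡ l c f) (*-comm c _))

    sum-const : (l : List A) (c : ℕ) → ∑[ _ ∈ l ] c ≡ length l * c
    sum-const []      c = refl
    sum-const (x ∷ l) c = cong (c +_) (sum-const l c)

    sum-zero : (l : List A) (f : A → ℕ) → (∀ x → f x ≡ 0) → sumOver l f ≡ 0
    sum-zero l f e = trans (sum-cong l e) (trans (sum-const l 0) (*-zeroʳ (length l)))

  module _ {A B : Set} where

    sum-map : (g : A → B) (l : List A) (f : B → ℕ) → sumOver (map g l) f ≡ ∑[ x ∈ l ] f (g x)
    sum-map g []      f = refl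
    sum-map g (x ∷ l) f = cong (f (g x) +_) (sum-map g l f)

    sum-concatMap : (g : A → List B) (l : List A) (f : B → ℕ) →
      sumOver (concatMap g l) f ≡ ∑[ x ∈ l ] sumOver (g x) f
    sum-concatMap g []      f = refl
    sum-concatMap g (x ∷ l) f =
      trans (sum-++ (g x) (concatMap g l) f) (cong (sumOver (g x) f +_) (sum-concatMap g l f))

    sum-swap : (l : List A) (m : List B) (f : A → B → ℕ) →
      ∑[ x ∈ l ] ∑[ y ∈ m ] f x y ≡ ∑[ y ∈ m ] ∑[ x ∈ l ] f x y
    sum-swap []      m f = sym (sum-zero m (λ _ → 0) (λ _ → refl))
    sum-swap (x ∷ l) m f = trans (cong (sumOver m (f x) +_) (sum-swap l m f))
      (sym (sum-+ m (f x) (λ y → ∑[ x' ∈ l ] f x' y)))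

  module _ {P Q : Set} where

    𝟙-× : (p : Dec P) (q : Dec Q) → 𝟙 (p ×-dec q) ≡ 𝟙 p * 𝟙 q
    𝟙-× (yes _) (yes _) = refl
    𝟙-× (yes _) (no _)  = refl
    𝟙-× (no _)  _       = refl

    𝟙-⊎ : (p : Dec P) (q : Dec Q) → (P → ¬ Q) → 𝟙 (p ⊎-dec q) ≡ 𝟙 p + 𝟙 q
    𝟙-⊎ (yes a) (yes b) disj = ⊥-elim (disj a b)
    𝟙-⊎ (yes _) (no _)  disj = refl
    𝟙-⊎ (no _)  (yes _) disj = refl
    𝟙-⊎ (no _)  (no _)  disj = refl

    𝟙-⇔ : (p : Dec P) (q : Dec Q) → (P → Q) → (Q → P) → 𝟙 p ≡ 𝟙 q
    𝟙-⇔ (yes _) (yes _) f g = refl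
    𝟙-⇔ (yes a) (no b)  f g = ⊥-elim (b (f a))
    𝟙-⇔ (no a)  (yes b) f g = ⊥-elim (a (g b))
    𝟙-⇔ (no _)  (no _)  f g = refl

  𝟙-yes : {P : Set} (p : Dec P) → P → 𝟙 p ≡ 1
  𝟙-yes (yes _) _ = refl
  𝟙-yes (no n)  a = ⊥-elim (n a)

  𝟙-no : {P : Set} (p : Dec P) → ¬ P → 𝟙 p ≡ 0
  𝟙-no (yes a) n = ⊥-elim (n a)
  𝟙-no (no _)  _ = refl

  𝟙-idem : {P : Set} (p : Dec P) → 𝟙 p * 𝟙 p ≡ 𝟙 p
  𝟙-idem (yes _) = refl
  𝟙-idem (no _)  = refl

module ThreeValued {A : Set} (s : A → ℕ) {a b : ℕ}
                   (a≢0 : ¬ a ≡ 0) (b≢0 : ¬ b ≡ 0) (a≢b : ¬ a ≡ b) where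

  open import Data.Nat using (_+_; _*_; _≟_)
  open import Data.Nat.Properties using (+-identityʳ; *-identityʳ)
  open import Data.List using (List; length; filter)
  open import Data.List.Relation.Unary.All as All using (All)
  open import Data.Product using (_,_; proj₁; proj₂)
  open import Data.Sum using (inj₁; inj₂)
  open import Relation.Binary.PropositionalEquality
    using (refl; cong; cong₂; sym; trans; module ≡-Reasoning)
  open FiniteSums

  OneOfThree : ℕ → Set
  OneOfThree m = m ≡ 0 ⊎ m ≡ a ⊎ m ≡ b

  count : ℕ → List A → ℕ
  count k l = length (filter (λ x → s x ≟ k) l)

  value-split : ∀ m → OneOfThree m →
    (1 ≡ 𝟙 (m ≟ 0) + 𝟙 (m ≟ a) + 𝟙 (m ≟ b)) ×
    (m ≡ 𝟙 (m ≟ a) * a + 𝟙 (m ≟ b) * b) ×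
    (m * m ≡ 𝟙 (m ≟ a) * (a * a) + 𝟙 (m ≟ b) * (b * b))
  value-split .0 (inj₁ refl)
    rewrite 𝟙-yes (0 ≟ 0) refl | 𝟙-no (0 ≟ a) (λ e → a≢0 (sym e)) | 𝟙-no (0 ≟ b) (λ e → b≢0 (sym e))
    = refl , refl , refl
  value-split .a (inj₂ (inj₁ refl))
    rewrite 𝟙-no (a ≟ 0) a≢0 | 𝟙-yes (a ≟ a) refl | 𝟙-no (a ≟ b) a≢b
    = refl , sym (trans (+-identityʳ _) (+-identityʳ a)) , sym (trans (+-identityʳ _) (+-identityʳ _))
  value-split .b (inj₂ (inj₂ refl))
    rewrite 𝟙-no (b ≟ 0) b≢0 | 𝟙-no (b ≟ a) (λ e → a≢b (sym e)) | 𝟙-yes (b ≟ b) refl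
    = refl , sym (+-identityʳ b) , sym (+-identityʳ _)

  module _ (l : List A) (three : All (λ x → OneOfThree (s x)) l) where
    open ≡-Reasoning

    split : ∀ {f g : ℕ → ℕ} → (∀ m → OneOfThree m → f m ≡ g m) →
      ∑[ x ∈ l ] f (s x) ≡ ∑[ x ∈ l ] g (s x)
    split h = sum-congAll (All.map (λ {x} → h (s x)) three)

    count-total : length l ≡ count 0 l + count a l + count b l
    count-total = begin
      length l                                               ≡⟨ sym (trans (sum-const l 1) (*-identityʳ _)) ⟩
      ∑[ x ∈ l ] 1                                           ≡⟨ split (λ m h → proj₁ (value-split m h)) ⟩
      ∑[ x ∈ l ] (𝟙 (s x ≟ 0) + 𝟙 (s x ≟ a) + 𝟙 (s x ≟ b))   ≡⟨ trans (sum-+ l _ _) (cong (_+ _) (sum-+ l _ _)) ⟩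
      ∑[ x ∈ l ] 𝟙 (s x ≟ 0) + ∑[ x ∈ l ] 𝟙 (s x ≟ a) + ∑[ x ∈ l ] 𝟙 (s x ≟ b)
        ≡⟨ sym (cong₂ _+_ (cong₂ _+_ (length-filter _ l) (length-filter _ l)) (length-filter _ l)) ⟩
      count 0 l + count a l + count b l                      ∎

    first-moment : ∑[ x ∈ l ] s x ≡ count a l * a + count b l * b
    first-moment = begin
      ∑[ x ∈ l ] s x                                         ≡⟨ split (λ m h → proj₁ (proj₂ (value-split m h))) ⟩
      ∑[ x ∈ l ] (𝟙 (s x ≟ a) * a + 𝟙 (s x ≟ b) * b)         ≡⟨ trans (sum-+ l _ _) (cong₂ _+_ (sum-*ʳ l a _) (sum-*ʳ l b _)) ⟩
      (∑[ x ∈ l ] 𝟙 (s x ≟ a)) * a + (∑[ x ∈ l ] 𝟙 (s x ≟ b)) * b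
        ≡⟨ sym (cong₂ _+_ (cong (_* a) (length-filter _ l)) (cong (_* b) (length-filter _ l))) ⟩
      count a l * a + count b l * b                          ∎

    second-moment : ∑[ x ∈ l ] s x * s x ≡ count a l * (a * a) + count b l * (b * b)
    second-moment = begin
      ∑[ x ∈ l ] s x * s x                                   ≡⟨ split (λ m h → proj₂ (proj₂ (value-split m h))) ⟩
      ∑[ x ∈ l ] (𝟙 (s x ≟ a) * (a * a) + 𝟙 (s x ≟ b) * (b * b))
        ≡⟨ trans (sum-+ l _ _) (cong₂ _+_ (sum-*ʳ l (a * a) _) (sum-*ʳ l (b * b) _)) ⟩
      (∑[ x ∈ l ] 𝟙 (s x ≟ a)) * (a * a) + (∑[ x ∈ l ] 𝟙 (s x ≟ b)) * (b * b)
        ≡⟨ sym (cong₂ _+_ (cong (_* (a * a)) (length-filter _ l)) (cong (_* (b * b)) (length-filter _ l))) ⟩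
      count a l * (a * a) + count b l * (b * b)              ∎

module DiagonalSum where

  open import Data.Nat using (zero; suc; _+_; _*_; _∸_)
  open import Data.Nat.Solver using (module +-*-Solver)
  open +-*-Solver using (solve; _:+_; _:*_; _:=_; con)
  open import Data.List using (List; []; _∷_; length)
  open import Data.List.Relation.Unary.All as All using (All; []; _∷_)
  open import Data.List.Relation.Unary.AllPairs using (AllPairs; []; _∷_)
  open import Data.Product using (_,_; proj₁; proj₂)
  open import Relation.Binary.PropositionalEquality using (refl; cong; cong₂; sym; trans)
  open FiniteSums

  orderedPairs : ℕ → ℕ
  orderedPairs n = n * (n ∸ 1)

  orderedPairs-suc : ∀ n → orderedPairs (suc n) ≡ n + n + orderedPairs n
  orderedPairs-suc zero    = refl
  orderedPairs-suc (suc n) =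
    solve 1 (λ n → (con 2 :+ n) :* (con 1 :+ n) := (con 1 :+ n) :+ (con 1 :+ n) :+ (con 1 :+ n) :* n) refl n

  module _ {A : Set} {R : A → A → Set} {Q : A → Set} (f : A → A → ℕ) {a b : ℕ}
           (diagonal : ∀ {u} → Q u → f u u ≡ a)
           (off-diagonal : ∀ {u v} → Q u → Q v → R u v → f u v ≡ b × f v u ≡ b) where

    -- split off the first row and column and recurse
    diagonal-sum : (l : List A) → AllPairs R l → All Q l →
      ∑[ u ∈ l ] ∑[ v ∈ l ] f u v ≡ length l * a + orderedPairs (length l) * b
    diagonal-sum []      []          []        = refl
    diagonal-sum (x ∷ l) (rx ∷ rl) (qx ∷ ql) = trans
      (cong₂ _+_ (cong₂ _+_ (diagonal qx) (row proj₁))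
        (trans (sum-+ l (λ u → f u x) (λ u → sumOver l (f u)))
          (cong₂ _+_ (row proj₂) (diagonal-sum l rl ql))))
      (trans
        (solve 4 (λ a b n p → (a :+ n :* b) :+ (n :* b :+ (n :* a :+ p :* b))
                            := (a :+ n :* a) :+ (n :+ n :+ p) :* b) refl a b (length l) (orderedPairs (length l)))
        (cong (λ p → a + length l * a + p * b) (sym (orderedPairs-suc (length l)))))
      where
      row : ∀ {g : A → ℕ} → (∀ {v} → (f x v ≡ b × f v x ≡ b) → g v ≡ b) → sumOver l g ≡ length l * b
      row pick = trans (sum-congAll (All.zipWith (λ (r , q) → pick (off-diagonal qx q r)) (rx , ql)))
                       (sum-const l b)

module Arithmetic where

  open import Data.Nat using (zero; suc; _+_; _*_; _∸_; _^_; _/_; NonZero; >-nonZero; >-nonZero⁻¹)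
  open import Data.Nat.Properties
    using (*-cancelʳ-≡; +-cancelʳ-≡; +-cancelˡ-≡; +-assoc; +-identityʳ; m+n∸m≡n; m*n≢0; <-≤-trans; m≤m+n)
  open import Data.Nat.DivMod using (m*n/n≡m)
  open import Data.Nat.Solver using (module +-*-Solver)
  open +-*-Solver using (solve; Polynomial; _:+_; _:*_; _:^_; _:=_; con)
  open import Data.Product using (_,_; proj₁; proj₂)
  open import Relation.Binary.PropositionalEquality
    using (refl; cong; cong₂; sym; trans; subst; module ≡-Reasoning)
  open DiagonalSum using (orderedPairs)

  -- θ q n = 1 + q + ⋯ + q^(n−1), the number of points of PG(n−1, q)
  θ : ℕ → ℕ → ℕ
  θ q zero    = 0
  θ q (suc n) = q ^ n + θ q n

  -- If A = B + D, the second moment minus A times the first moment only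
  -- involves the b-class:  b·B·D + (w·A² + b·B²) = (w·A + b·B)·A.
  moment-elimination : ∀ {A B D} w b → A ≡ B + D →
    b * (B * D) + (w * (A * A) + b * (B * B)) ≡ (w * A + b * B) * A
  moment-elimination {B = B} {D} w b refl =
    solve 4 (λ w b B D → b :* (B :* D) :+ (w :* ((B :+ D) :* (B :+ D)) :+ b :* (B :* B))
                       := (w :* (B :+ D) :+ b :* B) :* (B :+ D)) refl w b B D

  moments-determine-counts : ∀ {A B D} .{{_ : NonZero B}} .{{_ : NonZero D}} → A ≡ B + D →
    ∀ {w b w′ b′} →
    w * A + b * B ≡ w′ * A + b′ * B →
    w * (A * A) + b * (B * B) ≡ w′ * (A * A) + b′ * (B * B) →
    w ≡ w′ × b ≡ b′
  moments-determine-counts {A} {B} {D} A≡B+D {w} {b} {w′} {b′} first second =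
    w≡w′ , b≡b′
    where
    instance
      nzBD : NonZero (B * D)
      nzBD = m*n≢0 B D
      nzA : NonZero A
      nzA = subst NonZero (sym A≡B+D) (>-nonZero (<-≤-trans (>-nonZero⁻¹ B) (m≤m+n B D)))
    b≡b′ : b ≡ b′
    b≡b′ = *-cancelʳ-≡ b b′ (B * D) (+-cancelʳ-≡ _ _ _ (begin
      b * (B * D) + (w * (A * A) + b * (B * B))     ≡⟨ moment-elimination w b A≡B+D ⟩
      (w * A + b * B) * A                           ≡⟨ cong (_* A) first ⟩
      (w′ * A + b′ * B) * A                         ≡⟨ sym (moment-elimination w′ b′ A≡B+D) ⟩
      b′ * (B * D) + (w′ * (A * A) + b′ * (B * B))  ≡⟨ cong (b′ * (B * D) +_) (sym second) ⟩
      b′ * (B * D) + (w * (A * A) + b * (B * B))    ∎))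
      where open ≡-Reasoning
    w≡w′ : w ≡ w′
    w≡w′ = *-cancelʳ-≡ w w′ A (+-cancelʳ-≡ _ _ _ (trans first (cong (λ c → w′ * A + c * B) (sym b≡b′))))

  -- The quantities of the theorem for even q = 2m, m = k + 1, as polynomials in k.
  module EvenOrder (k : ℕ) where

    m q A B D L L-1 W : ℕ
    m   = suc k
    q   = m * 2
    A   = m * m * m * 4                 -- q³/2: solids through a white point
    B   = m * m * 2 * suc (k * 2)       -- (q³ − q²)/2: solids through a black point
    D   = m * m * 2
    L   = A * suc (k * 2)               -- q³(q − 1)/2 = |𝓔|
    L-1 = 8 * (k * k * k * k) + 28 * (k * k * k) + 36 * (k * k) + 20 * k + 3
    W   = 4 * (k * k) + 8 * k + 3       -- q² − 1

    Expr : Set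
    Expr = Polynomial 1
    m̂ q̂ Â B̂ D̂ L̂ L̂-1 Ŵ θ̂₃ θ̂₄ : Expr → Expr
    m̂ k   = con 1 :+ k
    q̂ k   = m̂ k :* con 2
    Â k   = m̂ k :* m̂ k :* m̂ k :* con 4
    B̂ k   = m̂ k :* m̂ k :* con 2 :* (con 1 :+ k :* con 2)
    D̂ k   = m̂ k :* m̂ k :* con 2
    L̂ k   = Â k :* (con 1 :+ k :* con 2)
    L̂-1 k = con 8 :* (k :* k :* k :* k) :+ con 28 :* (k :* k :* k) :+ con 36 :* (k :* k) :+ con 20 :* k :+ con 3
    Ŵ k   = con 4 :* (k :* k) :+ con 8 :* k :+ con 3
    θ̂₃ k  = q̂ k :^ 2 :+ (q̂ k :^ 1 :+ (q̂ k :^ 0 :+ con 0))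
    θ̂₄ k  = q̂ k :^ 3 :+ θ̂₃ k

    A≡B+D : A ≡ B + D
    A≡B+D = solve 1 (λ k → Â k := B̂ k :+ D̂ k) refl k

    L≡1+L-1 : L ≡ suc L-1
    L≡1+L-1 = solve 1 (λ k → L̂ k := con 1 :+ L̂-1 k) refl k

    q²-1≡W : q ^ 2 ∸ 1 ≡ W
    q²-1≡W = cong (_∸ 1) (solve 1 (λ k → q̂ k :^ 2 := con 1 :+ Ŵ k) refl k)

    -- the three halvings occurring in the statement are exact
    white-value : q ^ 3 / 2 ≡ A
    white-value = trans (cong (_/ 2) (solve 1 (λ k → q̂ k :^ 3 := Â k :* con 2) refl k)) (m*n/n≡m A 2)

    black-value : (q ^ 3 ∸ q ^ 2) / 2 ≡ B
    black-value = begin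
      (q ^ 3 ∸ q ^ 2) / 2
        ≡⟨ cong (λ c → (c ∸ q ^ 2) / 2) (solve 1 (λ k → q̂ k :^ 3 := q̂ k :^ 2 :+ B̂ k :* con 2) refl k) ⟩
      (q ^ 2 + B * 2 ∸ q ^ 2) / 2  ≡⟨ cong (_/ 2) (m+n∸m≡n (q ^ 2) (B * 2)) ⟩
      B * 2 / 2                    ≡⟨ m*n/n≡m B 2 ⟩
      B                            ∎
      where open ≡-Reasoning

    size-value : q ^ 3 * (q ∸ 1) / 2 ≡ L
    size-value = trans (cong (_/ 2) (solve 1 (λ k → q̂ k :^ 3 :* (con 1 :+ k :* con 2) := L̂ k :* con 2) refl k))
                       (m*n/n≡m L 2)

    expected-total : (q + 2) + W + (q ^ 4 + q ^ 3) ≡ θ q 5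
    expected-total = solve 1 (λ k → (q̂ k :+ con 2) :+ Ŵ k :+ (q̂ k :^ 4 :+ q̂ k :^ 3) := q̂ k :^ 4 :+ θ̂₄ k) refl k

    expected-first : W * A + (q ^ 4 + q ^ 3) * B ≡ L * θ q 4
    expected-first = solve 1 (λ k → Ŵ k :* Â k :+ (q̂ k :^ 4 :+ q̂ k :^ 3) :* B̂ k := L̂ k :* θ̂₄ k) refl k

    expected-second : W * (A * A) + (q ^ 4 + q ^ 3) * (B * B) ≡ L * θ q 4 + orderedPairs L * θ q 3
    expected-second = trans
      (solve 1 (λ k → Ŵ k :* (Â k :* Â k) :+ (q̂ k :^ 4 :+ q̂ k :^ 3) :* (B̂ k :* B̂ k)
                    := L̂ k :* θ̂₄ k :+ (L̂ k :* L̂-1 k) :* θ̂₃ k) refl k)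
      (cong (λ p → L * θ q 4 + L * p * θ q 3) (sym (cong (_∸ 1) L≡1+L-1)))

  counts-from-moments : ∀ q k → q ≡ suc k * 2 → ∀ {r w b L} →
    L ≡ q ^ 3 * (q ∸ 1) / 2 →
    r + w + b ≡ θ q 5 →
    w * (q ^ 3 / 2) + b * ((q ^ 3 ∸ q ^ 2) / 2) ≡ L * θ q 4 →
    w * (q ^ 3 / 2 * (q ^ 3 / 2)) + b * ((q ^ 3 ∸ q ^ 2) / 2 * ((q ^ 3 ∸ q ^ 2) / 2))
      ≡ L * θ q 4 + orderedPairs L * θ q 3 →
    (r ≡ q + 2) × (w ≡ q ^ 2 ∸ 1) × (b ≡ q ^ 4 + q ^ 3)
  counts-from-moments .(suc k * 2) k refl {r} {w} {b} refl total first second =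
    r≡ , trans w≡W (sym q²-1≡W) , b≡
    where
    open EvenOrder k
    open ≡-Reasoning

    first′ : w * A + b * B ≡ W * A + (q ^ 4 + q ^ 3) * B
    first′ = begin
      w * A + b * B                                    ≡⟨ cong₂ (λ x y → w * x + b * y) white-value black-value ⟨
      w * (q ^ 3 / 2) + b * ((q ^ 3 ∸ q ^ 2) / 2)      ≡⟨ first ⟩
      q ^ 3 * (q ∸ 1) / 2 * θ q 4                      ≡⟨ cong (_* θ q 4) size-value ⟩
      L * θ q 4                                        ≡⟨ expected-first ⟨
      W * A + (q ^ 4 + q ^ 3) * B                      ∎

    second′ : w * (A * A) + b * (B * B) ≡ W * (A * A) + (q ^ 4 + q ^ 3) * (B * B)
    second′ = begin
      w * (A * A) + b * (B * B)
        ≡⟨ cong₂ (λ x y → w * (x * x) + b * (y * y)) white-value black-value ⟨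
      w * (q ^ 3 / 2 * (q ^ 3 / 2)) + b * ((q ^ 3 ∸ q ^ 2) / 2 * ((q ^ 3 ∸ q ^ 2) / 2))
        ≡⟨ second ⟩
      q ^ 3 * (q ∸ 1) / 2 * θ q 4 + orderedPairs (q ^ 3 * (q ∸ 1) / 2) * θ q 3
        ≡⟨ cong (λ l → l * θ q 4 + orderedPairs l * θ q 3) size-value ⟩
      L * θ q 4 + orderedPairs L * θ q 3
        ≡⟨ expected-second ⟨
      W * (A * A) + (q ^ 4 + q ^ 3) * (B * B)          ∎

    w≡W×b≡ : w ≡ W × b ≡ q ^ 4 + q ^ 3
    w≡W×b≡ = moments-determine-counts A≡B+D first′ second′

    w≡W : w ≡ W
    w≡W = proj₁ w≡W×b≡

    b≡ : b ≡ q ^ 4 + q ^ 3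
    b≡ = proj₂ w≡W×b≡

    r≡ : r ≡ q + 2
    r≡ = +-cancelʳ-≡ (W + (q ^ 4 + q ^ 3)) r (q + 2) (begin
      r + (W + (q ^ 4 + q ^ 3))     ≡⟨ +-assoc r W _ ⟨
      r + W + (q ^ 4 + q ^ 3)       ≡⟨ cong₂ (λ x y → r + x + y) w≡W b≡ ⟨
      r + w + b                     ≡⟨ total ⟩
      θ q 5                         ≡⟨ expected-total ⟨
      q + 2 + W + (q ^ 4 + q ^ 3)   ≡⟨ +-assoc (q + 2) W _ ⟩
      q + 2 + (W + (q ^ 4 + q ^ 3)) ∎)

  valencies-distinct : ∀ q k → q ≡ suc k * 2 →
    ¬ q ^ 3 / 2 ≡ 0 × ¬ (q ^ 3 ∸ q ^ 2) / 2 ≡ 0 × ¬ q ^ 3 / 2 ≡ (q ^ 3 ∸ q ^ 2) / 2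
  valencies-distinct .(suc k * 2) k refl =
    (λ e → A≢0 (trans (sym white-value) e)) ,
    (λ e → B≢0 (trans (sym black-value) e)) ,
    (λ e → A≢B (trans (sym white-value) (trans e black-value)))
    where
    open EvenOrder k
    A≢0 : ¬ A ≡ 0
    A≢0 ()
    B≢0 : ¬ B ≡ 0
    B≢0 ()
    A≢B : ¬ A ≡ B
    A≢B A≡B with +-cancelˡ-≡ B D 0 (trans (sym A≡B+D) (trans A≡B (sym (+-identityʳ B))))
    ... | ()

-- The points of PG(n − 1, q) are the normalised vectors of Fⁿ.
module ProjectiveCounting (F : FiniteField) where

  open FiniteField F
  open PG F using (allVecs; Normalised; normalised?; dot)
  open import Data.Nat using (zero; suc; _^_; NonZero) renaming (_+_ to _+ℕ_; _*_ to _*ℕ_)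
  import Data.Nat.Properties as ℕP
  open import Data.List using (List; []; _∷_; length; filter; concatMap; map)
  open import Data.List.Relation.Unary.All as All using (All; []; _∷_)
  open import Data.List.Relation.Unary.All.Properties using (All¬⇒¬Any; map⁺; concat⁺; filter⁺; all-filter)
  open import Data.List.Relation.Unary.Any as Any using (Any; here; there)
  open import Data.List.Relation.Unary.AllPairs as AllPairs using (AllPairs; []; _∷_)
  import Data.List.Relation.Unary.AllPairs.Properties as AllPairsP
  open import Data.Vec using (Vec; []; _∷_; zipWith)
  import Data.Vec.Relation.Unary.All as VAll
  import Data.Vec.Relation.Unary.Any as VAny
  open import Data.Vec.Relation.Binary.Pointwise.Inductive as Pointwise using (Pointwise; []; _∷_)
  open import Data.Product using (_,_; proj₁; proj₂; ∃)
  open import Data.Sum using (inj₁; inj₂)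
  open import Data.Empty using (⊥-elim)
  open import Relation.Nullary using (Dec; yes; no; ¬?)
  open import Relation.Nullary.Decidable using (_×-dec_)
  open import Relation.Unary using (Pred; Decidable)
  open import Level using (0ℓ)
  import Relation.Binary.PropositionalEquality as ≡
  import Relation.Binary.Reasoning.Setoid
  module ≈-Reasoning = Relation.Binary.Reasoning.Setoid setoid
  open import Algebra.Properties.Ring ring
    using (+-cancelʳ; -‿distribˡ-*; -‿distribʳ-*; +-inverseʳ-unique)
  open import Algebra.Solver.Ring.NaturalCoefficients.Default commutativeSemiring
    using (solve; _:+_; _:*_; _:=_)
  open import Data.Nat.Solver using (module +-*-Solver)
  open +-*-Solver using () renaming (solve to ℕ-solve; _:+_ to _:+ℕ_; _:*_ to _:*ℕ_; _:=_ to _:=ℕ_)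
  open FiniteSums
  open DiagonalSum using (orderedPairs; diagonal-sum)
  open Arithmetic using (θ)

  q : ℕ
  q = order

  left-inverse : ∀ {a} → ¬ a ≈ 0# → ∃ λ a⁻¹ → a⁻¹ * a ≈ 1#
  left-inverse {a} a≉0 with inverse a a≉0
  ... | a⁻¹ , aa⁻¹≈1 = a⁻¹ , trans (*-comm a⁻¹ a) aa⁻¹≈1

  *-cancelˡ-nonzero : ∀ {a x y} → ¬ a ≈ 0# → a * x ≈ a * y → x ≈ y
  *-cancelˡ-nonzero {a} {x} {y} a≉0 ax≈ay with left-inverse a≉0
  ... | a⁻¹ , a⁻¹a≈1 = begin
    x              ≈⟨ *-identityˡ x ⟨
    1# * x         ≈⟨ *-congʳ a⁻¹a≈1 ⟨
    (a⁻¹ * a) * x  ≈⟨ *-assoc a⁻¹ a x ⟩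
    a⁻¹ * (a * x)  ≈⟨ *-congˡ ax≈ay ⟩
    a⁻¹ * (a * y)  ≈⟨ *-assoc a⁻¹ a y ⟨
    (a⁻¹ * a) * y  ≈⟨ *-congʳ a⁻¹a≈1 ⟩
    1# * y         ≈⟨ *-identityˡ y ⟩
    y              ∎
    where open ≈-Reasoning

  -- the shape in which a linear form a·x + D appears after a translation t
  shift-term : ∀ t a x D → t + (a * x + D) ≈ (t + D) + a * x
  shift-term = solve 4 (λ t a x D → t :+ (a :* x :+ D) := (t :+ D) :+ a :* x) refl

  module LinearEquation {a : Carrier} (a≉0 : ¬ a ≈ 0#) (t D d : Carrier) where

    a⁻¹ : Carrier
    a⁻¹ = proj₁ (left-inverse a≉0)

    root : Carrier
    root = a⁻¹ * (d + - (t + D))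

    root-solves : t + (a * root + D) ≈ d
    root-solves = begin
      t + (a * (a⁻¹ * e) + D)      ≈⟨ shift-term t a _ D ⟩
      (t + D) + a * (a⁻¹ * e)      ≈⟨ +-congˡ (*-assoc a a⁻¹ e) ⟨
      (t + D) + (a * a⁻¹) * e      ≈⟨ +-congˡ (*-congʳ (trans (*-comm a a⁻¹) (proj₂ (left-inverse a≉0)))) ⟩
      (t + D) + 1# * e             ≈⟨ +-congˡ (*-identityˡ e) ⟩
      (t + D) + (d + - (t + D))    ≈⟨ +-congˡ (+-comm d _) ⟩
      (t + D) + (- (t + D) + d)    ≈⟨ +-assoc (t + D) _ d ⟨
      ((t + D) + - (t + D)) + d    ≈⟨ +-congʳ (-‿inverseʳ (t + D)) ⟩
      0# + d                       ≈⟨ +-identityˡ d ⟩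
      d                            ∎
      where
      open ≈-Reasoning
      e : Carrier
      e = d + - (t + D)

    root-unique : ∀ {x} → t + (a * x + D) ≈ d → x ≈ root
    root-unique {x} x-solves = *-cancelˡ-nonzero a≉0 (+-cancelʳ (t + D) _ _ (begin
      a * x + (t + D)       ≈⟨ +-comm _ _ ⟩
      (t + D) + a * x       ≈⟨ shift-term t a x D ⟨
      t + (a * x + D)       ≈⟨ x-solves ⟩
      d                     ≈⟨ root-solves ⟨
      t + (a * root + D)    ≈⟨ shift-term t a root D ⟩
      (t + D) + a * root    ≈⟨ +-comm _ _ ⟩
      a * root + (t + D)    ∎))
      where open ≈-Reasoning

  indicator-resp : ∀ {x y} d → x ≈ y → 𝟙 (x ≈? d) ≡ 𝟙 (y ≈? d)
  indicator-resp d x≈y = 𝟙-⇔ (_ ≈? d) (_ ≈? d) (trans (sym x≈y)) (trans x≈y)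

  occurs-once : ∀ y (l : List Carrier) → AllPairs (λ a b → ¬ a ≈ b) l → Any (y ≈_) l →
    ∑[ x ∈ l ] 𝟙 (x ≈? y) ≡ 1
  occurs-once y (e ∷ es) (e∉es ∷ _) (here y≈e) =
    ≡.cong₂ _+ℕ_ (𝟙-yes (e ≈? y) (sym y≈e))
      (≡.trans (sum-congAll (All.map (λ e≉z → 𝟙-no (_ ≈? y) (λ z≈y → e≉z (trans (sym y≈e) (sym z≈y)))) e∉es))
               (sum-zero es (λ _ → 0) (λ _ → ≡.refl)))
  occurs-once y (e ∷ es) (e∉es ∷ distinct-es) (there y∈es) =
    ≡.trans (≡.cong (_+ℕ _) (𝟙-no (e ≈? y) (λ e≈y → All¬⇒¬Any e∉es (Any.map (trans e≈y) y∈es))))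
            (occurs-once y es distinct-es y∈es)

  exactly-one : ∀ y → ∑[ x ∈ elems ] 𝟙 (x ≈? y) ≡ 1
  exactly-one y = occurs-once y elems distinct (complete y)

  sum-at : ∀ y (h : Carrier → ℕ) → (∀ {x x′} → x ≈ x′ → h x ≡ h x′) →
    ∑[ x ∈ elems ] 𝟙 (x ≈? y) *ℕ h x ≡ h y
  sum-at y h h-resp = begin
    ∑[ x ∈ elems ] 𝟙 (x ≈? y) *ℕ h x    ≡⟨ sum-cong elems move ⟩
    ∑[ x ∈ elems ] 𝟙 (x ≈? y) *ℕ h y    ≡⟨ sum-*ʳ elems (h y) _ ⟩
    (∑[ x ∈ elems ] 𝟙 (x ≈? y)) *ℕ h y  ≡⟨ ≡.cong (_*ℕ h y) (exactly-one y) ⟩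
    1 *ℕ h y                            ≡⟨ ℕP.*-identityˡ (h y) ⟩
    h y                                 ∎
    where
    open ≡.≡-Reasoning
    move : ∀ x → 𝟙 (x ≈? y) *ℕ h x ≡ 𝟙 (x ≈? y) *ℕ h y
    move x with x ≈? y
    ... | yes x≈y = ≡.cong (1 *ℕ_) (h-resp x≈y)
    ... | no _    = ≡.refl

  linear-count : ∀ {a} → ¬ a ≈ 0# → ∀ t D d → ∑[ x ∈ elems ] 𝟙 ((t + (a * x + D)) ≈? d) ≡ 1
  linear-count a≉0 t D d = ≡.trans
    (sum-cong elems (λ x → 𝟙-⇔ (_ ≈? d) (x ≈? root) root-unique
      (λ x≈root → trans (+-congˡ (+-congʳ (*-congˡ x≈root))) root-solves)))
    (exactly-one root)
    where open LinearEquation a≉0 t D d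

  NonZeroVec : ∀ {n} → Vec Carrier n → Set
  NonZeroVec v = VAny.Any (λ c → ¬ c ≈ 0#) v

  nonZeroVec? : ∀ {n} (v : Vec Carrier n) → Dec (NonZeroVec v)
  nonZeroVec? v = VAny.any? (λ c → ¬? (c ≈? 0#)) v

  ZeroVec : ∀ {n} → Vec Carrier n → Set
  ZeroVec v = VAll.All (_≈ 0#) v

  zero-if-not-nonzero : ∀ {n} (v : Vec Carrier n) → ¬ NonZeroVec v → ZeroVec v
  zero-if-not-nonzero []      _ = VAll.[]
  zero-if-not-nonzero (c ∷ v) v≢0 with c ≈? 0#
  ... | yes c≈0 = c≈0 VAll.∷ zero-if-not-nonzero v (λ v′≢0 → v≢0 (VAny.there v′≢0))
  ... | no c≉0  = ⊥-elim (v≢0 (VAny.here c≉0))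

  dot-zeroˡ : ∀ {n} {u : Vec Carrier n} (xs : Vec Carrier n) → ZeroVec u → dot u xs ≈ 0#
  dot-zeroˡ []       VAll.[]          = refl
  dot-zeroˡ (x ∷ xs) (u₀≈0 VAll.∷ u≈0) =
    trans (+-cong (trans (*-congʳ u₀≈0) (zeroˡ x)) (dot-zeroˡ xs u≈0)) (+-identityʳ 0#)

  sum-F^suc : ∀ n (f : Vec Carrier (suc n) → ℕ) →
    sumOver (allVecs (suc n)) f ≡ ∑[ x ∈ elems ] ∑[ xs ∈ allVecs n ] f (x ∷ xs)
  sum-F^suc n f = ≡.trans (sum-concatMap (λ x → map (x ∷_) (allVecs n)) elems f)
    (sum-cong elems (λ x → sum-map (x ∷_) (allVecs n) f))

  sum-F-const : ∀ c → ∑[ _ ∈ elems ] c ≡ q *ℕ c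
  sum-F-const c = ≡.trans (sum-const elems c) (≡.cong (_*ℕ c) length-elems)

  size-F^ : ∀ n → ∑[ _ ∈ allVecs n ] 1 ≡ q ^ n
  size-F^ zero    = ≡.refl
  size-F^ (suc n) = ≡.trans (sum-F^suc n (λ _ → 1))
    (≡.trans (sum-cong elems (λ _ → size-F^ n)) (sum-F-const (q ^ n)))

  -- By
  -- induction on n: if b₀ ≠ 0 every choice of the other coordinates extends
  -- uniquely, otherwise the first coordinate is free.
  affine-hyperplane : ∀ n (b : Vec Carrier n) → NonZeroVec b → ∀ t d →
    (∑[ xs ∈ allVecs n ] 𝟙 ((t + dot b xs) ≈? d)) *ℕ q ≡ q ^ n
  affine-hyperplane (suc n) (b₀ ∷ b) (VAny.here b₀≉0) t d = begin
    (∑[ xs ∈ allVecs (suc n) ] 𝟙 ((t + dot (b₀ ∷ b) xs) ≈? d)) *ℕ q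
      ≡⟨ ≡.cong (_*ℕ q) (sum-F^suc n _) ⟩
    (∑[ x ∈ elems ] ∑[ xs ∈ allVecs n ] 𝟙 ((t + (b₀ * x + dot b xs)) ≈? d)) *ℕ q
      ≡⟨ ≡.cong (_*ℕ q) (sum-swap elems (allVecs n) _) ⟩
    (∑[ xs ∈ allVecs n ] ∑[ x ∈ elems ] 𝟙 ((t + (b₀ * x + dot b xs)) ≈? d)) *ℕ q
      ≡⟨ ≡.cong (_*ℕ q) (sum-cong (allVecs n) (λ xs → linear-count b₀≉0 t (dot b xs) d)) ⟩
    (∑[ xs ∈ allVecs n ] 1) *ℕ q
      ≡⟨ ≡.cong (_*ℕ q) (size-F^ n) ⟩
    q ^ n *ℕ q
      ≡⟨ ℕP.*-comm (q ^ n) q ⟩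
    q ^ suc n ∎
    where open ≡.≡-Reasoning
  affine-hyperplane (suc n) (b₀ ∷ b) (VAny.there b≢0) t d = begin
    (∑[ xs ∈ allVecs (suc n) ] 𝟙 ((t + dot (b₀ ∷ b) xs) ≈? d)) *ℕ q
      ≡⟨ ≡.cong (_*ℕ q) (sum-F^suc n _) ⟩
    (∑[ x ∈ elems ] ∑[ xs ∈ allVecs n ] 𝟙 ((t + (b₀ * x + dot b xs)) ≈? d)) *ℕ q
      ≡⟨ sum-*ʳ elems q _ ⟨
    ∑[ x ∈ elems ] (∑[ xs ∈ allVecs n ] 𝟙 ((t + (b₀ * x + dot b xs)) ≈? d)) *ℕ q
      ≡⟨ sum-cong elems (λ x → ≡.trans (≡.cong (_*ℕ q) (sum-cong (allVecs n) (λ xs →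
           indicator-resp d (sym (+-assoc t (b₀ * x) (dot b xs))))))
           (affine-hyperplane n b b≢0 (t + b₀ * x) d)) ⟩
    ∑[ x ∈ elems ] q ^ n
      ≡⟨ sum-F-const (q ^ n) ⟩
    q ^ suc n ∎
    where open ≡.≡-Reasoning

  -- Points of projective space.

  normalised-cons : ∀ {n} x (xs : Vec Carrier n) →
    𝟙 (normalised? (x ∷ xs)) ≡ 𝟙 (x ≈? 1#) +ℕ 𝟙 (x ≈? 0#) *ℕ 𝟙 (normalised? xs)
  normalised-cons x xs = ≡.trans
    (𝟙-⊎ (x ≈? 1#) ((x ≈? 0#) ×-dec normalised? xs) (λ x≈1 (x≈0 , _) → 1≉0 (trans (sym x≈1) x≈0)))
    (≡.cong (𝟙 (x ≈? 1#) +ℕ_) (𝟙-× (x ≈? 0#) (normalised? xs)))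

  -- A point of PG(n, q) is either (1, xs) with xs ∈ Fⁿ (an affine point) or
  -- (0, p) with p a point of PG(n − 1, q) (a point at infinity).
  points-split : ∀ n (g : Vec Carrier (suc n) → ℕ) → (∀ {x x′} xs → x ≈ x′ → g (x ∷ xs) ≡ g (x′ ∷ xs)) →
    ∑[ v ∈ allVecs (suc n) ] 𝟙 (normalised? v) *ℕ g v ≡
      ∑[ xs ∈ allVecs n ] g (1# ∷ xs) +ℕ ∑[ xs ∈ allVecs n ] 𝟙 (normalised? xs) *ℕ g (0# ∷ xs)
  points-split n g g-resp = begin
    ∑[ v ∈ allVecs (suc n) ] 𝟙 (normalised? v) *ℕ g v
      ≡⟨ sum-F^suc n _ ⟩
    ∑[ x ∈ elems ] ∑[ xs ∈ allVecs n ] 𝟙 (normalised? (x ∷ xs)) *ℕ g (x ∷ xs)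
      ≡⟨ sum-cong elems by-first-coordinate ⟩
    ∑[ x ∈ elems ] (𝟙 (x ≈? 1#) *ℕ affine x +ℕ 𝟙 (x ≈? 0#) *ℕ infinite x)
      ≡⟨ sum-+ elems _ _ ⟩
    ∑[ x ∈ elems ] 𝟙 (x ≈? 1#) *ℕ affine x +ℕ ∑[ x ∈ elems ] 𝟙 (x ≈? 0#) *ℕ infinite x
      ≡⟨ ≡.cong₂ _+ℕ_ (sum-at 1# affine (λ x≈x′ → sum-cong (allVecs n) (λ xs → g-resp xs x≈x′)))
                      (sum-at 0# infinite (λ x≈x′ → sum-cong (allVecs n) (λ xs →
                         ≡.cong (𝟙 (normalised? xs) *ℕ_) (g-resp xs x≈x′)))) ⟩
    affine 1# +ℕ infinite 0# ∎
    where
    open ≡.≡-Reasoning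
    affine infinite : Carrier → ℕ
    affine   x = ∑[ xs ∈ allVecs n ] g (x ∷ xs)
    infinite x = ∑[ xs ∈ allVecs n ] 𝟙 (normalised? xs) *ℕ g (x ∷ xs)

    by-first-coordinate : ∀ x →
      ∑[ xs ∈ allVecs n ] 𝟙 (normalised? (x ∷ xs)) *ℕ g (x ∷ xs)
        ≡ 𝟙 (x ≈? 1#) *ℕ affine x +ℕ 𝟙 (x ≈? 0#) *ℕ infinite x
    by-first-coordinate x = begin
      ∑[ xs ∈ allVecs n ] 𝟙 (normalised? (x ∷ xs)) *ℕ g (x ∷ xs)
        ≡⟨ sum-cong (allVecs n) (λ xs → ≡.trans (≡.cong (_*ℕ g (x ∷ xs)) (normalised-cons x xs))
             (distribute (𝟙 (x ≈? 1#)) (𝟙 (x ≈? 0#)) (𝟙 (normalised? xs)) (g (x ∷ xs)))) ⟩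
      ∑[ xs ∈ allVecs n ] (𝟙 (x ≈? 1#) *ℕ g (x ∷ xs) +ℕ 𝟙 (x ≈? 0#) *ℕ (𝟙 (normalised? xs) *ℕ g (x ∷ xs)))
        ≡⟨ ≡.trans (sum-+ (allVecs n) _ _) (≡.cong₂ _+ℕ_ (sum-*ˡ (allVecs n) (𝟙 (x ≈? 1#)) _)
                                                         (sum-*ˡ (allVecs n) (𝟙 (x ≈? 0#)) _)) ⟩
      𝟙 (x ≈? 1#) *ℕ affine x +ℕ 𝟙 (x ≈? 0#) *ℕ infinite x ∎
      where
      distribute : ∀ a b c d → (a +ℕ b *ℕ c) *ℕ d ≡ a *ℕ d +ℕ b *ℕ (c *ℕ d)
      distribute = ℕ-solve 4 (λ a b c d → (a :+ℕ b :*ℕ c) :*ℕ d :=ℕ a :*ℕ d :+ℕ b :*ℕ (c :*ℕ d)) ≡.refl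

  point-count : ∀ n → ∑[ v ∈ allVecs n ] 𝟙 (normalised? v) ≡ θ q n
  point-count zero    = ≡.refl
  point-count (suc n) = begin
    ∑[ v ∈ allVecs (suc n) ] 𝟙 (normalised? v)
      ≡⟨ sum-cong (allVecs (suc n)) (λ v → ℕP.*-identityʳ _) ⟨
    ∑[ v ∈ allVecs (suc n) ] 𝟙 (normalised? v) *ℕ 1
      ≡⟨ points-split n (λ _ → 1) (λ _ _ → ≡.refl) ⟩
    ∑[ xs ∈ allVecs n ] 1 +ℕ ∑[ xs ∈ allVecs n ] 𝟙 (normalised? xs) *ℕ 1
      ≡⟨ ≡.cong₂ _+ℕ_ (size-F^ n)
           (≡.trans (sum-cong (allVecs n) (λ v → ℕP.*-identityʳ _)) (point-count n)) ⟩
    q ^ n +ℕ θ q n ∎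
    where open ≡.≡-Reasoning

  -- F has at least one element, so q ≠ 0
  instance
    q≢0 : NonZero q
    q≢0 = ≡.subst NonZero length-elems (nonempty elems (complete 0#))
      where
      nonempty : (l : List Carrier) → Any (0# ≈_) l → NonZero (length l)
      nonempty (_ ∷ _) _ = _

  form-at-infinity : ∀ a D → a * 0# + D ≈ D
  form-at-infinity a D = trans (+-congʳ (zeroʳ a)) (+-identityˡ D)

  head-nonzero : ∀ {n u₀} {u′ : Vec Carrier n} → NonZeroVec (u₀ ∷ u′) → ¬ NonZeroVec u′ → ¬ u₀ ≈ 0#
  head-nonzero (VAny.here u₀≉0)   _     = u₀≉0
  head-nonzero (VAny.there u′≢0) u′≢̸0 = ⊥-elim (u′≢̸0 u′≢0)

  affine-form-nonzero : ∀ {n u₀} {u′ : Vec Carrier n} → ¬ u₀ ≈ 0# → ZeroVec u′ →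
    ∀ xs → ¬ (u₀ * 1# + dot u′ xs) ≈ 0#
  affine-form-nonzero {u₀ = u₀} {u′} u₀≉0 u′≈0 xs u₀+u′xs≈0 = u₀≉0 (begin
    u₀                  ≈⟨ *-identityʳ u₀ ⟨
    u₀ * 1#             ≈⟨ +-identityʳ _ ⟨
    u₀ * 1# + 0#        ≈⟨ +-congˡ (dot-zeroˡ xs u′≈0) ⟨
    u₀ * 1# + dot u′ xs ≈⟨ u₀+u′xs≈0 ⟩
    0#                  ∎)
    where open ≈-Reasoning

  -- If the tail u′ of u is nonzero,
  -- there are qⁿ⁻¹ affine points and, by induction, θ(n − 1) at infinity;
  -- otherwise u₀ ≠ 0, no affine point lies on it and every point at
  -- infinity does.
  hyperplane-points : ∀ n (u : Vec Carrier (suc n)) → NonZeroVec u →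
    ∑[ x ∈ allVecs (suc n) ] 𝟙 (normalised? x) *ℕ 𝟙 (dot u x ≈? 0#) ≡ θ q n
  hyperplane-points n (u₀ ∷ u′) u≢0 = begin
    ∑[ x ∈ allVecs (suc n) ] 𝟙 (normalised? x) *ℕ 𝟙 (dot (u₀ ∷ u′) x ≈? 0#)
      ≡⟨ points-split n (λ x → 𝟙 (dot (u₀ ∷ u′) x ≈? 0#)) (λ xs x≈x′ → indicator-resp 0# (+-congʳ (*-congˡ x≈x′))) ⟩
    affine n u′ +ℕ ∑[ xs ∈ allVecs n ] 𝟙 (normalised? xs) *ℕ 𝟙 ((u₀ * 0# + dot u′ xs) ≈? 0#)
      ≡⟨ ≡.cong (affine n u′ +ℕ_) (sum-cong (allVecs n) (λ xs →
           ≡.cong (𝟙 (normalised? xs) *ℕ_) (indicator-resp 0# (form-at-infinity u₀ (dot u′ xs))))) ⟩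
    affine n u′ +ℕ ∑[ xs ∈ allVecs n ] 𝟙 (normalised? xs) *ℕ 𝟙 (dot u′ xs ≈? 0#)
      ≡⟨ by-tail n u′ u≢0 (nonZeroVec? u′) ⟩
    θ q n ∎
    where
    open ≡.≡-Reasoning
    affine : ∀ n → Vec Carrier n → ℕ
    affine n u′ = ∑[ xs ∈ allVecs n ] 𝟙 ((u₀ * 1# + dot u′ xs) ≈? 0#)

    by-tail : ∀ n (u′ : Vec Carrier n) → NonZeroVec (u₀ ∷ u′) → Dec (NonZeroVec u′) →
      affine n u′ +ℕ ∑[ xs ∈ allVecs n ] 𝟙 (normalised? xs) *ℕ 𝟙 (dot u′ xs ≈? 0#) ≡ θ q n
    by-tail (suc n′) u′ _ (yes u′≢0) = ≡.cong₂ _+ℕ_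
      (ℕP.*-cancelʳ-≡ _ _ q (≡.trans (affine-hyperplane (suc n′) u′ u′≢0 (u₀ * 1#) 0#) (ℕP.*-comm q (q ^ n′))))
      (hyperplane-points n′ u′ u′≢0)
    by-tail n u′ u≢0 (no u′≢̸0) = ≡.cong₂ _+ℕ_
      (sum-zero (allVecs n) _ (λ xs → 𝟙-no _ (affine-form-nonzero (head-nonzero u≢0 u′≢̸0) u′≈0 xs)))
      (≡.trans (sum-cong (allVecs n) (λ xs → ≡.trans
          (≡.cong (𝟙 (normalised? xs) *ℕ_) (𝟙-yes (dot u′ xs ≈? 0#) (dot-zeroˡ xs u′≈0)))
          (ℕP.*-identityʳ _)))
        (point-count n))
      where
      u′≈0 : ZeroVec u′
      u′≈0 = zero-if-not-nonzero u′ u′≢̸0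

  -- Linear independence of two linear forms.

  Multiple : ∀ {n} → Carrier → Vec Carrier n → Vec Carrier n → Set
  Multiple l = Pointwise (λ aᵢ bᵢ → bᵢ ≈ l * aᵢ)

  multiple? : ∀ {n} l (a b : Vec Carrier n) → Dec (Multiple l a b)
  multiple? l = Pointwise.decidable (λ aᵢ bᵢ → bᵢ ≈? (l * aᵢ))

  multiple-resp : ∀ {n l l′} {a b : Vec Carrier n} → l ≈ l′ → Multiple l a b → Multiple l′ a b
  multiple-resp l≈l′ = Pointwise.map (λ bᵢ≈laᵢ → trans bᵢ≈laᵢ (*-congʳ l≈l′))

  multiple-dot : ∀ {n l} {a b : Vec Carrier n} xs → Multiple l a b → dot b xs ≈ l * dot a xs
  multiple-dot {l = l} []       []                 = sym (zeroʳ l)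
  multiple-dot {l = l} (x ∷ xs) (bᵢ≈laᵢ ∷ b≈la) = trans
    (+-cong (trans (*-congʳ bᵢ≈laᵢ) (*-assoc l _ x)) (multiple-dot xs b≈la))
    (sym (distribˡ l _ _))

  zero-is-multiple : ∀ {n} {a b : Vec Carrier n} → ZeroVec b → Multiple 0# a b
  zero-is-multiple {a = []}    VAll.[]            = []
  zero-is-multiple {a = a ∷ _} (bᵢ≈0 VAll.∷ b≈0) = trans bᵢ≈0 (sym (zeroˡ a)) ∷ zero-is-multiple b≈0

  zero-multiple : ∀ {n} {a b : Vec Carrier n} → Multiple 0# a b → ZeroVec b
  zero-multiple []                = VAll.[]
  zero-multiple (bᵢ≈0aᵢ ∷ b≈0a) = trans bᵢ≈0aᵢ (zeroˡ _) VAll.∷ zero-multiple b≈0a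

  nonzero-not-zero : ∀ {n} {a : Vec Carrier n} → NonZeroVec a → ¬ ZeroVec a
  nonzero-not-zero (VAny.here aᵢ≉0) (aᵢ≈0 VAll.∷ _) = aᵢ≉0 aᵢ≈0
  nonzero-not-zero (VAny.there a≢0) (_ VAll.∷ a≈0) = nonzero-not-zero a≢0 a≈0

  multiple-invert : ∀ {n l l⁻¹} {a b : Vec Carrier n} → l⁻¹ * l ≈ 1# → Multiple l b a → Multiple l⁻¹ a b
  multiple-invert l⁻¹l≈1 []                 = []
  multiple-invert {l = l} {l⁻¹} l⁻¹l≈1 (_∷_ {x = bᵢ} {y = aᵢ} aᵢ≈lbᵢ a≈lb) = (begin
    bᵢ               ≈⟨ *-identityˡ bᵢ ⟨
    1# * bᵢ          ≈⟨ *-congʳ l⁻¹l≈1 ⟨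
    (l⁻¹ * l) * bᵢ   ≈⟨ *-assoc l⁻¹ l bᵢ ⟩
    l⁻¹ * (l * bᵢ)   ≈⟨ *-congˡ aᵢ≈lbᵢ ⟨
    l⁻¹ * aᵢ         ∎) ∷ multiple-invert l⁻¹l≈1 a≈lb
    where open ≈-Reasoning

  Independent : ∀ {n} → Vec Carrier n → Vec Carrier n → Set
  Independent a b = NonZeroVec a × (∀ l → ¬ Multiple l a b)

  no-multiple : ∀ {n} (a b : Vec Carrier n) → ¬ Any (λ l → Multiple l a b) elems → ∀ l → ¬ Multiple l a b
  no-multiple a b none l b≈la = none (Any.map (λ l≈x → multiple-resp l≈x b≈la) (complete l))

  independent-sym : ∀ {n} {a b : Vec Carrier n} → Independent a b → Independent b a
  independent-sym {a = a} {b} (a≢0 , b∉Fa) = b≢0 (nonZeroVec? b) , a∉Fb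
    where
    b≢0 : Dec (NonZeroVec b) → NonZeroVec b
    b≢0 (yes b≢0) = b≢0
    b≢0 (no b≢̸0) = ⊥-elim (b∉Fa 0# (zero-is-multiple (zero-if-not-nonzero b b≢̸0)))
    a∉Fb : ∀ l → ¬ Multiple l b a
    a∉Fb l a≈lb with l ≈? 0#
    ... | yes l≈0 = nonzero-not-zero a≢0 (zero-multiple (multiple-resp l≈0 a≈lb))
    ... | no l≉0  = b∉Fa _ (multiple-invert (proj₂ (left-inverse l≉0)) a≈lb)

  independent-tail : ∀ {n a₀ b₀} {a b : Vec Carrier n} → a₀ ≈ 0# → b₀ ≈ 0# →
    Independent (a₀ ∷ a) (b₀ ∷ b) → Independent a b
  independent-tail {a = a} a₀≈0 b₀≈0 (a≢0 , b∉Fa) = tail≢0 a≢0 , λ l b≈la →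
    b∉Fa l (trans b₀≈0 (sym (trans (*-congˡ a₀≈0) (zeroʳ l))) ∷ b≈la)
    where
    tail≢0 : NonZeroVec (_ ∷ a) → NonZeroVec a
    tail≢0 (VAny.here a₀≉0) = ⊥-elim (a₀≉0 a₀≈0)
    tail≢0 (VAny.there a≢0) = a≢0

  no-independent-pair-F¹ : ∀ (a b : Vec Carrier 1) → ¬ Independent a b
  no-independent-pair-F¹ (x ∷ []) (y ∷ []) (VAny.here x≉0 , y∉Fx) = y∉Fx (y * x⁻¹) ((begin
    y                ≈⟨ *-identityʳ y ⟨
    y * 1#           ≈⟨ *-congˡ x⁻¹x≈1 ⟨
    y * (x⁻¹ * x)    ≈⟨ *-assoc y x⁻¹ x ⟨
    (y * x⁻¹) * x    ∎) ∷ [])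
    where
    open ≈-Reasoning
    x⁻¹ : Carrier
    x⁻¹ = proj₁ (left-inverse x≉0)
    x⁻¹x≈1 : x⁻¹ * x ≈ 1#
    x⁻¹x≈1 = proj₂ (left-inverse x≉0)

  -- The intersection of two affine hyperplanes with independent normals.

  combine : ∀ {n} → Carrier → Vec Carrier n → Vec Carrier n → Vec Carrier n
  combine ν b a = zipWith (λ bᵢ aᵢ → bᵢ + ν * aᵢ) b a

  dot-combine : ∀ {n} ν (b a xs : Vec Carrier n) → dot (combine ν b a) xs ≈ dot b xs + ν * dot a xs
  dot-combine ν []       []       []       = sym (trans (+-congˡ (zeroʳ ν)) (+-identityʳ 0#))
  dot-combine ν (bᵢ ∷ b) (aᵢ ∷ a) (x ∷ xs) = trans (+-congˡ (dot-combine ν b a xs))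
    (solve 6 (λ bᵢ ν aᵢ x B A → (bᵢ :+ ν :* aᵢ) :* x :+ (B :+ ν :* A) := (bᵢ :* x :+ B) :+ ν :* (aᵢ :* x :+ A))
       refl bᵢ ν aᵢ x (dot b xs) (dot a xs))

  -- eliminating the first coordinate from independent forms leaves a nonzero form
  combine-nonzero : ∀ {n a₀ b₀ ν} {a b : Vec Carrier n} → ν * a₀ + b₀ ≈ 0# →
    Independent (a₀ ∷ a) (b₀ ∷ b) → NonZeroVec (combine ν b a)
  combine-nonzero {a₀ = a₀} {b₀} {ν} {a} {b} νa₀+b₀≈0 (_ , b∉Fa) with nonZeroVec? (combine ν b a)
  ... | yes c≢0 = c≢0
  ... | no c≢̸0 = ⊥-elim (b∉Fa (- ν) (head ∷ tail a b (zero-if-not-nonzero _ c≢̸0)))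
    where
    solved : ∀ {x y} → ν * x + y ≈ 0# → y ≈ - ν * x
    solved νx+y≈0 = trans (+-inverseʳ-unique _ _ νx+y≈0) (-‿distribˡ-* ν _)
    head : b₀ ≈ - ν * a₀
    head = solved νa₀+b₀≈0
    tail : ∀ {m} (a b : Vec Carrier m) → ZeroVec (combine ν b a) → Multiple (- ν) a b
    tail []       []       VAll.[]         = []
    tail (aᵢ ∷ a) (bᵢ ∷ b) (e VAll.∷ es) = solved (trans (+-comm _ _) e) ∷ tail a b es

  -- If a₀ ≠ 0, solving s + a·x = c for x₀ turns t + b·x = d into a single
  -- affine equation in the other coordinates, with nonzero normal b − (b₀/a₀)·a.
  pivot : ∀ n a₀ (a : Vec Carrier n) b₀ b → ¬ a₀ ≈ 0# → Independent (a₀ ∷ a) (b₀ ∷ b) → ∀ s c t d →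
    (∑[ xs ∈ allVecs (suc n) ] 𝟙 ((s + dot (a₀ ∷ a) xs) ≈? c) *ℕ 𝟙 ((t + dot (b₀ ∷ b) xs) ≈? d)) *ℕ q *ℕ q
      ≡ q ^ suc n
  pivot n a₀ a b₀ b a₀≉0 independent s c t d = begin
    (∑[ xs ∈ allVecs (suc n) ] 𝟙 ((s + dot (a₀ ∷ a) xs) ≈? c) *ℕ 𝟙 ((t + dot (b₀ ∷ b) xs) ≈? d)) *ℕ q *ℕ q
      ≡⟨ ≡.cong (λ z → z *ℕ q *ℕ q) (≡.trans (sum-F^suc n _) (sum-swap elems (allVecs n) _)) ⟩
    (∑[ xs ∈ allVecs n ] ∑[ x ∈ elems ] 𝟙 (first xs x) *ℕ 𝟙 (second xs x)) *ℕ q *ℕ q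
      ≡⟨ ≡.cong (λ z → z *ℕ q *ℕ q) (sum-cong (allVecs n) eliminate-x₀) ⟩
    (∑[ xs ∈ allVecs n ] 𝟙 ((t′ + dot b′ xs) ≈? d)) *ℕ q *ℕ q
      ≡⟨ ≡.cong (_*ℕ q) (affine-hyperplane n b′ (combine-nonzero νa₀+b₀≈0 independent) t′ d) ⟩
    q ^ n *ℕ q
      ≡⟨ ℕP.*-comm (q ^ n) q ⟩
    q ^ suc n ∎
    where
    open ≡.≡-Reasoning
    a₀⁻¹ μ ν t′ : Carrier
    a₀⁻¹ = proj₁ (left-inverse a₀≉0)
    μ    = b₀ * a₀⁻¹
    ν    = - μ
    t′   = t + (μ * c + ν * s)
    b′ : Vec Carrier n
    b′ = combine ν b a

    first : ∀ xs x → Dec ((s + (a₀ * x + dot a xs)) ≈ c)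
    first xs x = (s + (a₀ * x + dot a xs)) ≈? c
    second : ∀ xs x → Dec ((t + (b₀ * x + dot b xs)) ≈ d)
    second xs x = (t + (b₀ * x + dot b xs)) ≈? d

    νa₀+b₀≈0 : ν * a₀ + b₀ ≈ 0#
    νa₀+b₀≈0 = begin≈
      ν * a₀ + b₀            ≈⟨ +-congʳ (-‿distribˡ-* μ a₀) ⟨
      - (μ * a₀) + b₀        ≈⟨ +-congʳ (-‿cong μa₀≈b₀) ⟩
      - b₀ + b₀              ≈⟨ -‿inverseˡ b₀ ⟩
      0#                     ∎≈
      where
      open ≈-Reasoning renaming (begin_ to begin≈_; _∎ to _∎≈)
      μa₀≈b₀ : μ * a₀ ≈ b₀
      μa₀≈b₀ = trans (*-assoc b₀ a₀⁻¹ a₀) (trans (*-congˡ (proj₂ (left-inverse a₀≉0))) (*-identityʳ b₀))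

    substitute : ∀ xs → let open LinearEquation a₀≉0 s (dot a xs) c in
      t + (b₀ * root + dot b xs) ≈ t′ + dot b′ xs
    substitute xs = begin≈
      t + (b₀ * (a₀⁻¹ * (c + - (s + A))) + B)  ≈⟨ +-congˡ (+-congʳ (trans (sym (*-assoc b₀ a₀⁻¹ _)) (distribˡ μ c _))) ⟩
      t + ((μ * c + μ * - (s + A)) + B)        ≈⟨ +-congˡ (+-congʳ (+-congˡ (trans (sym (-‿distribʳ-* μ _)) (-‿distribˡ-* μ _)))) ⟩
      t + ((μ * c + ν * (s + A)) + B)          ≈⟨ solve 7 (λ t μ c ν s A B → t :+ ((μ :* c :+ ν :* (s :+ A)) :+ B)
                                                   := (t :+ (μ :* c :+ ν :* s)) :+ (B :+ ν :* A)) refl t μ c ν s A B ⟩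
      t′ + (B + ν * A)                         ≈⟨ +-congˡ (dot-combine ν b a xs) ⟨
      t′ + dot b′ xs                           ∎≈
      where
      open ≈-Reasoning renaming (begin_ to begin≈_; _∎ to _∎≈)
      A B : Carrier
      A = dot a xs
      B = dot b xs

    eliminate-x₀ : ∀ xs → ∑[ x ∈ elems ] 𝟙 (first xs x) *ℕ 𝟙 (second xs x) ≡ 𝟙 ((t′ + dot b′ xs) ≈? d)
    eliminate-x₀ xs = begin
      ∑[ x ∈ elems ] 𝟙 (first xs x) *ℕ 𝟙 (second xs x)
        ≡⟨ sum-cong elems (λ x → ≡.cong (_*ℕ 𝟙 (second xs x)) (𝟙-⇔ (first xs x) (x ≈? root) root-unique
             (λ x≈root → trans (+-congˡ (+-congʳ (*-congˡ x≈root))) root-solves))) ⟩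
      ∑[ x ∈ elems ] 𝟙 (x ≈? root) *ℕ 𝟙 (second xs x)
        ≡⟨ sum-at root (λ x → 𝟙 (second xs x)) (λ x≈x′ → indicator-resp d (+-congˡ (+-congʳ (*-congˡ x≈x′)))) ⟩
      𝟙 (second xs root)
        ≡⟨ indicator-resp d (substitute xs) ⟩
      𝟙 ((t′ + dot b′ xs) ≈? d) ∎
      where open LinearEquation a₀≉0 s (dot a xs) c

  -- Two affine hyperplanes of Fⁿ with independent normals meet in qⁿ⁻² points:
  -- pivot on a coordinate where one normal is nonzero, or, if both vanish
  -- there, let that coordinate run freely.
  affine-codim2 : ∀ n (a b : Vec Carrier n) → Independent a b → ∀ s c t d →
    (∑[ xs ∈ allVecs n ] 𝟙 ((s + dot a xs) ≈? c) *ℕ 𝟙 ((t + dot b xs) ≈? d)) *ℕ q *ℕ q ≡ q ^ n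
  affine-codim2 zero    []       []       (() , _)
  affine-codim2 (suc n) (a₀ ∷ a) (b₀ ∷ b) independent s c t d with a₀ ≈? 0# | b₀ ≈? 0#
  ... | no a₀≉0  | _        = pivot n a₀ a b₀ b a₀≉0 independent s c t d
  ... | yes _    | no b₀≉0  =
    ≡.trans (≡.cong (λ z → z *ℕ q *ℕ q) (sum-cong (allVecs (suc n)) (λ xs → ℕP.*-comm (𝟙 (_ ≈? c)) _)))
            (pivot n b₀ b a₀ a b₀≉0 (independent-sym independent) t d s c)
  ... | yes a₀≈0 | yes b₀≈0 = begin
    (∑[ xs ∈ allVecs (suc n) ] 𝟙 ((s + dot (a₀ ∷ a) xs) ≈? c) *ℕ 𝟙 ((t + dot (b₀ ∷ b) xs) ≈? d)) *ℕ q *ℕ q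
      ≡⟨ ≡.cong (λ z → z *ℕ q *ℕ q) (sum-F^suc n _) ⟩
    (∑[ x ∈ elems ] slice x) *ℕ q *ℕ q
      ≡⟨ ≡.trans (sum-*ʳ elems q (λ x → slice x *ℕ q)) (≡.cong (_*ℕ q) (sum-*ʳ elems q slice)) ⟨
    ∑[ x ∈ elems ] slice x *ℕ q *ℕ q
      ≡⟨ sum-cong elems (λ x → ≡.trans (≡.cong (λ z → z *ℕ q *ℕ q) (shift x))
           (affine-codim2 n a b (independent-tail a₀≈0 b₀≈0 independent) (s + a₀ * x) c (t + b₀ * x) d)) ⟩
    ∑[ x ∈ elems ] q ^ n
      ≡⟨ sum-F-const (q ^ n) ⟩
    q ^ suc n ∎
    where
    open ≡.≡-Reasoning
    slice : Carrier → ℕ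
    slice x = ∑[ xs ∈ allVecs n ] 𝟙 ((s + (a₀ * x + dot a xs)) ≈? c) *ℕ 𝟙 ((t + (b₀ * x + dot b xs)) ≈? d)
    shift : ∀ x → slice x ≡
      ∑[ xs ∈ allVecs n ] 𝟙 ((s + a₀ * x + dot a xs) ≈? c) *ℕ 𝟙 ((t + b₀ * x + dot b xs) ≈? d)
    shift x = sum-cong (allVecs n) (λ xs → ≡.cong₂ _*ℕ_
      (indicator-resp c (sym (+-assoc s _ _))) (indicator-resp d (sym (+-assoc t _ _))))

  module Codim2 {m} (u₀ v₀ : Carrier) (u v : Vec Carrier (suc m)) where

    affine-part infinite-part : ℕ
    affine-part   = ∑[ xs ∈ allVecs (suc m) ] 𝟙 ((u₀ * 1# + dot u xs) ≈? 0#) *ℕ 𝟙 ((v₀ * 1# + dot v xs) ≈? 0#)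
    infinite-part = ∑[ xs ∈ allVecs (suc m) ] 𝟙 (normalised? xs) *ℕ (𝟙 (dot u xs ≈? 0#) *ℕ 𝟙 (dot v xs ≈? 0#))

    split : ∑[ x ∈ allVecs (suc (suc m)) ]
              𝟙 (normalised? x) *ℕ (𝟙 (dot (u₀ ∷ u) x ≈? 0#) *ℕ 𝟙 (dot (v₀ ∷ v) x ≈? 0#))
            ≡ affine-part +ℕ infinite-part
    split = ≡.trans
      (points-split (suc m) (λ x → 𝟙 (dot (u₀ ∷ u) x ≈? 0#) *ℕ 𝟙 (dot (v₀ ∷ v) x ≈? 0#))
        (λ xs x≈x′ → ≡.cong₂ _*ℕ_ (indicator-resp 0# (+-congʳ (*-congˡ x≈x′)))
                                  (indicator-resp 0# (+-congʳ (*-congˡ x≈x′)))))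
      (≡.cong (affine-part +ℕ_) (sum-cong (allVecs (suc m)) (λ xs → ≡.cong (𝟙 (normalised? xs) *ℕ_)
        (≡.cong₂ _*ℕ_ (indicator-resp 0# (form-at-infinity u₀ (dot u xs)))
                      (indicator-resp 0# (form-at-infinity v₀ (dot v xs)))))))

    -- tail u = 0: the first hyperplane has no affine point and contains
    -- the whole hyperplane at infinity, which meets the second in a hyperplane
    zero-tail : Independent (u₀ ∷ u) (v₀ ∷ v) → ZeroVec u → affine-part +ℕ infinite-part ≡ θ q m
    zero-tail (U≢0 , V∉FU) u≈0 = ≡.cong₂ _+ℕ_
      (sum-zero (allVecs (suc m)) _ (λ xs → ≡.cong (_*ℕ 𝟙 ((v₀ * 1# + dot v xs) ≈? 0#))
        (𝟙-no ((u₀ * 1# + dot u xs) ≈? 0#) (affine-form-nonzero u₀≉0 u≈0 xs))))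
      (≡.trans (sum-cong (allVecs (suc m)) (λ xs → ≡.cong (λ z → 𝟙 (normalised? xs) *ℕ (z *ℕ 𝟙 (dot v xs ≈? 0#)))
                  (𝟙-yes (dot u xs ≈? 0#) (dot-zeroˡ xs u≈0))))
        (≡.trans (sum-cong (allVecs (suc m)) (λ xs → ≡.cong (𝟙 (normalised? xs) *ℕ_) (ℕP.+-identityʳ _)))
          (hyperplane-points m v (v≢0 (nonZeroVec? v)))))
      where
      u₀≉0 : ¬ u₀ ≈ 0#
      u₀≉0 = head-nonzero U≢0 (λ u≢0 → nonzero-not-zero u≢0 u≈0)
      -- otherwise (v₀, v) = (v₀/u₀)·(u₀, 0)
      v≢0 : Dec (NonZeroVec v) → NonZeroVec v
      v≢0 (yes v≢0) = v≢0
      v≢0 (no v≢̸0) = ⊥-elim (V∉FU (v₀ * u₀⁻¹) (v₀≈lu₀ ∷ multiple-zero u≈0 (zero-if-not-nonzero v v≢̸0)))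
        where
        u₀⁻¹ : Carrier
        u₀⁻¹ = proj₁ (left-inverse u₀≉0)
        v₀≈lu₀ : v₀ ≈ v₀ * u₀⁻¹ * u₀
        v₀≈lu₀ = sym (trans (*-assoc v₀ u₀⁻¹ u₀) (trans (*-congˡ (proj₂ (left-inverse u₀≉0))) (*-identityʳ v₀)))
        multiple-zero : ∀ {k l} {a b : Vec Carrier k} → ZeroVec a → ZeroVec b → Multiple l a b
        multiple-zero VAll.[] VAll.[] = []
        multiple-zero {l = l} (aᵢ≈0 VAll.∷ a≈0) (bᵢ≈0 VAll.∷ b≈0) =
          trans bᵢ≈0 (sym (trans (*-congˡ aᵢ≈0) (zeroʳ l))) ∷ multiple-zero a≈0 b≈0

    -- v = l·u with u ≠ 0: no affine point lies on both (else (v₀, v) = l·(u₀, u)),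
    -- and at infinity the first hyperplane is contained in the second
    multiple-tail : ∀ {l} → Independent (u₀ ∷ u) (v₀ ∷ v) → NonZeroVec u → Multiple l u v →
      affine-part +ℕ infinite-part ≡ θ q m
    multiple-tail {l} (_ , V∉FU) u≢0 v≈lu = ≡.cong₂ _+ℕ_
      (sum-zero (allVecs (suc m)) _ not-both)
      (≡.trans (sum-cong (allVecs (suc m)) (λ xs → ≡.cong (𝟙 (normalised? xs) *ℕ_) (second-implied xs)))
        (hyperplane-points m u u≢0))
      where
      second-implied : ∀ xs → 𝟙 (dot u xs ≈? 0#) *ℕ 𝟙 (dot v xs ≈? 0#) ≡ 𝟙 (dot u xs ≈? 0#)
      second-implied xs with dot u xs ≈? 0#
      ... | no _     = ≡.refl
      ... | yes u·xs≈0 = ≡.trans (ℕP.+-identityʳ _) (𝟙-yes (dot v xs ≈? 0#)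
        (trans (multiple-dot xs v≈lu) (trans (*-congˡ u·xs≈0) (zeroʳ l))))
      not-both : ∀ xs → 𝟙 ((u₀ * 1# + dot u xs) ≈? 0#) *ℕ 𝟙 ((v₀ * 1# + dot v xs) ≈? 0#) ≡ 0
      not-both xs with (u₀ * 1# + dot u xs) ≈? 0# | (v₀ * 1# + dot v xs) ≈? 0#
      ... | no _ | _    = ≡.refl
      ... | yes _ | no _ = ≡.refl
      ... | yes first | yes second = ⊥-elim (V∉FU l (v₀≈lu₀ ∷ v≈lu))
        where
        open ≈-Reasoning
        U : Carrier
        U = dot u xs
        v₀≈lu₀ : v₀ ≈ l * u₀
        v₀≈lu₀ = begin
          v₀                  ≈⟨ *-identityʳ v₀ ⟨
          v₀ * 1#             ≈⟨ +-cancelʳ (l * U) _ _ (begin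
            v₀ * 1# + l * U         ≈⟨ +-congˡ (multiple-dot xs v≈lu) ⟨
            v₀ * 1# + dot v xs      ≈⟨ second ⟩
            0#                      ≈⟨ zeroʳ l ⟨
            l * 0#                  ≈⟨ *-congˡ first ⟨
            l * (u₀ * 1# + U)       ≈⟨ distribˡ l _ U ⟩
            l * (u₀ * 1#) + l * U   ∎) ⟩
          l * (u₀ * 1#)       ≈⟨ *-congˡ (*-identityʳ u₀) ⟩
          l * u₀              ∎

    independent-tails : Independent u v → affine-part *ℕ q *ℕ q ≡ q ^ suc m
    independent-tails independent = affine-codim2 (suc m) u v independent (u₀ * 1#) 0# (v₀ * 1#) 0#

  -- Two hyperplanes of PG(m + 1, q) with independent normals meet in θ(m)
  -- points.  Split off the points at infinity and distinguish how the tails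
  -- u, v of the normals are related.
  codim2-points : ∀ m (u v : Vec Carrier (suc (suc m))) → Independent u v →
    ∑[ x ∈ allVecs (suc (suc m)) ] 𝟙 (normalised? x) *ℕ (𝟙 (dot u x ≈? 0#) *ℕ 𝟙 (dot v x ≈? 0#)) ≡ θ q m
  codim2-points m (u₀ ∷ u) (v₀ ∷ v) independent
    with nonZeroVec? u | Any.any? (λ l → multiple? l u v) elems
  ... | no u≢̸0 | _ =
    ≡.trans split (zero-tail independent (zero-if-not-nonzero u u≢̸0))
    where open Codim2 u₀ v₀ u v
  ... | yes u≢0 | yes v∈Fu =
    ≡.trans split (multiple-tail independent u≢0 (proj₂ (Any.satisfied v∈Fu)))
    where open Codim2 u₀ v₀ u v
  codim2-points zero (u₀ ∷ u) (v₀ ∷ v) independent | yes u≢0 | no v∉Fu =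
    ⊥-elim (no-independent-pair-F¹ u v (u≢0 , no-multiple u v v∉Fu))
  codim2-points (suc m) (u₀ ∷ u) (v₀ ∷ v) independent | yes u≢0 | no v∉Fu =
    ≡.trans split (≡.cong₂ _+ℕ_ affine-count (codim2-points m u v tails-independent))
    where
    open Codim2 u₀ v₀ u v
    tails-independent : Independent u v
    tails-independent = u≢0 , no-multiple u v v∉Fu
    affine-count : affine-part ≡ q ^ m
    affine-count = ℕP.*-cancelʳ-≡ _ _ q (ℕP.*-cancelʳ-≡ _ _ q (≡.trans (independent-tails tails-independent)
      (ℕ-solve 2 (λ q p → q :*ℕ (q :*ℕ p) :=ℕ p :*ℕ q :*ℕ q) ≡.refl q (q ^ m))))

  normalised-nonzero : ∀ {n} (u : Vec Carrier n) → Normalised u → NonZeroVec u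
  normalised-nonzero (x ∷ u) (inj₁ x≈1)           = VAny.here (λ x≈0 → 1≉0 (trans (sym x≈1) x≈0))
  normalised-nonzero (x ∷ u) (inj₂ (_ , u-normal)) = VAny.there (normalised-nonzero u u-normal)

  multiple-one : ∀ {n l} {a b : Vec Carrier n} → l ≈ 1# → Multiple l a b → Pointwise _≈_ a b
  multiple-one l≈1 = Pointwise.map (λ bᵢ≈laᵢ → sym (trans bᵢ≈laᵢ (trans (*-congʳ l≈1) (*-identityˡ _))))

  -- two proportional normalised vectors are equal: the factor is 1, as both
  -- have the same first nonzero coordinate 1
  proportional-normalised : ∀ {n l} (a b : Vec Carrier n) → Normalised a → Normalised b →
    Multiple l a b → Pointwise _≈_ a b
  proportional-normalised {l = l} (a₀ ∷ a) (b₀ ∷ b) (inj₁ a₀≈1) b-normal (b₀≈la₀ ∷ b≈la) with b-normal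
  ... | inj₁ b₀≈1 = multiple-one l≈1 (b₀≈la₀ ∷ b≈la)
    where
    l≈1 : l ≈ 1#
    l≈1 = trans (sym (trans (*-congˡ a₀≈1) (*-identityʳ l))) (trans (sym b₀≈la₀) b₀≈1)
  ... | inj₂ (b₀≈0 , b-normal′) =
    ⊥-elim (nonzero-not-zero (normalised-nonzero b b-normal′) (zero-multiple (multiple-resp l≈0 b≈la)))
    where
    l≈0 : l ≈ 0#
    l≈0 = trans (sym (trans (*-congˡ a₀≈1) (*-identityʳ l))) (trans (sym b₀≈la₀) b₀≈0)
  proportional-normalised {l = l} (a₀ ∷ a) (b₀ ∷ b) (inj₂ (a₀≈0 , a-normal)) b-normal (b₀≈la₀ ∷ b≈la)
    with b-normal
  ... | inj₁ b₀≈1 = ⊥-elim (1≉0 (trans (sym b₀≈1) b₀≈0))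
    where
    b₀≈0 : b₀ ≈ 0#
    b₀≈0 = trans b₀≈la₀ (trans (*-congˡ a₀≈0) (zeroʳ l))
  ... | inj₂ (b₀≈0 , b-normal′) =
    trans a₀≈0 (sym b₀≈0) ∷ proportional-normalised a b a-normal b-normal′ b≈la

  distinct-points-independent : ∀ {n} (u v : Vec Carrier n) → Normalised u → Normalised v →
    ¬ Pointwise _≈_ u v → Independent u v
  distinct-points-independent u v u-normal v-normal u≉v =
    normalised-nonzero u u-normal , λ l v≈lu → u≉v (proportional-normalised u v u-normal v-normal v≈lu)

  allVecs-distinct : ∀ n → AllPairs (λ x y → ¬ Pointwise _≈_ x y) (allVecs n)
  allVecs-distinct zero    = [] ∷ []
  allVecs-distinct (suc n) = by-first elems distinct
    where
    heads-differ : ∀ {e} (es : List Carrier) → All (λ e′ → ¬ e ≈ e′) es →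
      All (λ y → ∀ xs → ¬ Pointwise _≈_ (e ∷ xs) y) (concatMap (λ e′ → map (e′ ∷_) (allVecs n)) es)
    heads-differ es e∉es = concat⁺ (map⁺ (All.map (λ e≉e′ →
      map⁺ (All.universal (λ ys xs e∷xs≈e′∷ys → e≉e′ (Pointwise.head e∷xs≈e′∷ys)) (allVecs n))) e∉es))

    by-first : (l : List Carrier) → AllPairs (λ a b → ¬ a ≈ b) l →
      AllPairs (λ x y → ¬ Pointwise _≈_ x y) (concatMap (λ e → map (e ∷_) (allVecs n)) l)
    by-first []       []              = []
    by-first (e ∷ es) (e∉es ∷ es-distinct) = AllPairsP.++⁺
      (AllPairsP.map⁺ (AllPairs.map (λ xs≉ys e∷xs≈e∷ys → xs≉ys (Pointwise.tail e∷xs≈e∷ys)) (allVecs-distinct n)))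
      (by-first es es-distinct)
      (map⁺ (All.universal (λ xs → All.map (λ y≉ → y≉ xs) (heads-differ es e∉es)) (allVecs n)))

  module SolidCounts (𝓔 : Pred (Vec Carrier 5) 0ℓ) (𝓔? : Decidable 𝓔) where

    open PG F using (points; solids; solidsThroughPoint)

    chosen : List (Vec Carrier 5)
    chosen = filter 𝓔? solids

    valency : Vec Carrier 5 → ℕ
    valency = solidsThroughPoint 𝓔 𝓔?

    valency-sum : ∀ x → valency x ≡ ∑[ u ∈ chosen ] 𝟙 (dot u x ≈? 0#)
    valency-sum x = ≡.trans (length-filter _ solids)
      (≡.trans (sum-cong solids (λ u → 𝟙-× (𝓔? u) (dot u x ≈? 0#))) (≡.sym (sum-filter 𝓔? solids _)))

    chosen-normalised : All Normalised chosen
    chosen-normalised = filter⁺ 𝓔? (all-filter normalised? (allVecs 5))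

    chosen-distinct : AllPairs (λ x y → ¬ Pointwise _≈_ x y) chosen
    chosen-distinct = AllPairsP.filter⁺ 𝓔? (AllPairsP.filter⁺ normalised? (allVecs-distinct 5))

    sum-points : (g : Vec Carrier 5 → ℕ) → sumOver points g ≡ ∑[ x ∈ allVecs 5 ] 𝟙 (normalised? x) *ℕ g x
    sum-points g = sum-filter normalised? (allVecs 5) g

    point-total : length points ≡ θ q 5
    point-total = ≡.trans (length-filter normalised? (allVecs 5)) (point-count 5)

    points-on-solid : ∀ u → Normalised u → ∑[ x ∈ points ] 𝟙 (dot u x ≈? 0#) ≡ θ q 4
    points-on-solid u u-normal = ≡.trans (sum-points _) (hyperplane-points 4 u (normalised-nonzero u u-normal))

    points-on-two-solids : ∀ u v → Normalised u → Normalised v → ¬ Pointwise _≈_ u v →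
      ∑[ x ∈ points ] 𝟙 (dot u x ≈? 0#) *ℕ 𝟙 (dot v x ≈? 0#) ≡ θ q 3
    points-on-two-solids u v u-normal v-normal u≉v = ≡.trans (sum-points _)
      (codim2-points 3 u v (distinct-points-independent u v u-normal v-normal u≉v))

    first-moment : ∑[ x ∈ points ] valency x ≡ length chosen *ℕ θ q 4
    first-moment = begin
      ∑[ x ∈ points ] valency x                           ≡⟨ sum-cong points valency-sum ⟩
      ∑[ x ∈ points ] ∑[ u ∈ chosen ] 𝟙 (dot u x ≈? 0#)   ≡⟨ sum-swap points chosen _ ⟩
      ∑[ u ∈ chosen ] ∑[ x ∈ points ] 𝟙 (dot u x ≈? 0#)   ≡⟨ sum-congAll (All.map (points-on-solid _) chosen-normalised) ⟩
      ∑[ u ∈ chosen ] θ q 4                               ≡⟨ sum-const chosen (θ q 4) ⟩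
      length chosen *ℕ θ q 4                              ∎
      where open ≡.≡-Reasoning

    second-moment : ∑[ x ∈ points ] valency x *ℕ valency x
      ≡ length chosen *ℕ θ q 4 +ℕ orderedPairs (length chosen) *ℕ θ q 3
    second-moment = begin
      ∑[ x ∈ points ] valency x *ℕ valency x
        ≡⟨ sum-cong points square ⟩
      ∑[ x ∈ points ] ∑[ u ∈ chosen ] ∑[ v ∈ chosen ] 𝟙 (dot u x ≈? 0#) *ℕ 𝟙 (dot v x ≈? 0#)
        ≡⟨ ≡.trans (sum-swap points chosen _) (sum-cong chosen (λ u → sum-swap points chosen _)) ⟩
      ∑[ u ∈ chosen ] ∑[ v ∈ chosen ] common u v
        ≡⟨ diagonal-sum common on-diagonal off-diagonal chosen chosen-distinct chosen-normalised ⟩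
      length chosen *ℕ θ q 4 +ℕ orderedPairs (length chosen) *ℕ θ q 3 ∎
      where
      open ≡.≡-Reasoning
      common : Vec Carrier 5 → Vec Carrier 5 → ℕ
      common u v = ∑[ x ∈ points ] 𝟙 (dot u x ≈? 0#) *ℕ 𝟙 (dot v x ≈? 0#)

      square : ∀ x → valency x *ℕ valency x
        ≡ ∑[ u ∈ chosen ] ∑[ v ∈ chosen ] 𝟙 (dot u x ≈? 0#) *ℕ 𝟙 (dot v x ≈? 0#)
      square x = ≡.trans (≡.cong₂ _*ℕ_ (valency-sum x) (valency-sum x))
        (≡.trans (≡.sym (sum-*ʳ chosen _ (λ u → 𝟙 (dot u x ≈? 0#))))
          (sum-cong chosen (λ u → ≡.sym (sum-*ˡ chosen (𝟙 (dot u x ≈? 0#)) (λ v → 𝟙 (dot v x ≈? 0#))))))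

      on-diagonal : ∀ {u} → Normalised u → common u u ≡ θ q 4
      on-diagonal {u} u-normal =
        ≡.trans (sum-cong points (λ x → 𝟙-idem (dot u x ≈? 0#))) (points-on-solid u u-normal)

      off-diagonal : ∀ {u v} → Normalised u → Normalised v → ¬ Pointwise _≈_ u v →
        common u v ≡ θ q 3 × common v u ≡ θ q 3
      off-diagonal {u} {v} u-normal v-normal u≉v =
        points-on-two-solids u v u-normal v-normal u≉v ,
        points-on-two-solids v u v-normal u-normal (λ v≈u → u≉v (Pointwise.sym sym v≈u))

open import Level using (0ℓ)
open import Data.Nat using (_+_; _*_; _∸_; _^_; _/_; _<_)
open import Data.Nat.Divisibility using (_∣_; divides)
open import Data.Nat.Properties using (n≮0)
open import Data.List.Membership.Propositional using (_∈_)
open import Data.List.Relation.Unary.All using (All; tabulate)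
open import Data.Product using (proj₁; proj₂)
open import Data.Empty using (⊥-elim)
open import Relation.Unary using (Pred; Decidable)
open import Relation.Binary.PropositionalEquality using (subst; sym; trans)

-- q = 2·0 contradicts q > 2; for q = 2(k + 1) combine the three double
-- counts with the three-valuedness of s and solve the moment equations.
lemma2p5 : (F : FiniteField) →
    2 < FiniteField.order F → 2 ∣ FiniteField.order F →
    (𝓔 : Pred (V5 F) 0ℓ) (𝓔? : Decidable 𝓔) →
    (∀ x → x ∈ PG.points F →
      PG.solidsThroughPoint F 𝓔 𝓔? x ≡ 0
      ⊎ PG.solidsThroughPoint F 𝓔 𝓔? x ≡ (FiniteField.order F ^ 3) / 2
      ⊎ PG.solidsThroughPoint F 𝓔 𝓔? x ≡ (FiniteField.order F ^ 3 ∸ FiniteField.order F ^ 2) / 2) →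
    (∀ x y z → PG.LinIndep3 F x y z →
      PG.solidsThroughPlane F 𝓔 𝓔? x y z ≡ 0
      ⊎ PG.solidsThroughPlane F 𝓔 𝓔? x y z ≡ FiniteField.order F / 2
      ⊎ PG.solidsThroughPlane F 𝓔 𝓔? x y z ≡ FiniteField.order F) →
    PG.size F 𝓔 𝓔? ≡ (FiniteField.order F ^ 3 * (FiniteField.order F ∸ 1)) / 2 →
    (PG.redCount F 𝓔 𝓔? ≡ FiniteField.order F + 2)
    × (PG.whiteCount F 𝓔 𝓔? ≡ FiniteField.order F ^ 2 ∸ 1)
    × (PG.blackCount F 𝓔 𝓔? ≡ FiniteField.order F ^ 4 + FiniteField.order F ^ 3)
lemma2p5 F 2<q (divides zero q≡0) _ _ _ _ _ = ⊥-elim (n≮0 (subst (2 <_) q≡0 2<q))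
lemma2p5 F 2<q (divides (suc k) q≡2[k+1]) 𝓔 𝓔? valency-values _ size =
  counts-from-moments q k q≡2[k+1] size
    (trans (sym (Moments.count-total points three-values)) point-total)
    (trans (sym (Moments.first-moment points three-values)) first-moment)
    (trans (sym (Moments.second-moment points three-values)) second-moment)
  where
  open ProjectiveCounting F using (q; module SolidCounts)
  open SolidCounts 𝓔 𝓔?
  open PG F using (points)
  open Arithmetic using (counts-from-moments; valencies-distinct)
  white black : ℕ
  white = q ^ 3 / 2
  black = (q ^ 3 ∸ q ^ 2) / 2
  distinct : ¬ white ≡ 0 × ¬ black ≡ 0 × ¬ white ≡ black
  distinct = valencies-distinct q k q≡2[k+1]
  module Moments = ThreeValued valency (proj₁ distinct) (proj₁ (proj₂ distinct)) (proj₂ (proj₂ distinct))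
  three-values : All (λ x → Moments.OneOfThree (valency x)) points
  three-values = tabulate (λ {x} → valency-values x)
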